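{- Let $(G,w)$ be a weighted trigraph and let $(A,B,C)$ be a cut-partition of $G$ such that $C=\{c_1,c_2\}$ is a stable set of size two of $G$. For each $X\in\{A,B\}$, let $G_X$ be the trigraph on $X\cup C$ in which $c_1c_2$ is a semi-adjacent pair and all other adjacencies are as in $G[X\cup C]$. For each $C'\subseteq C$, set $\alpha_{A\cup C'}=\alpha(\mathrm{Red}[G_A,w;A\cup C'])+\mathrm{Ext}[G_A,w;A\cup C']$. Define $w_B:D(G_B)\to\mathbb{N}$ by: $w_B(c_1)=\alpha_{A\cup C}-w(c_2)$; $w_B(c_2)=w(c_2)$; $w_B(c_1,c_2)=\alpha_{A\cup\{c_1\}}-\alpha_{A\cup C}+w(c_2)$; $w_B(c_2,c_1)=\alpha_{A\cup\{c_2\}}-w(c_2)$; $w_B(c_1c_2)=\alpha_A$; and $w_B(p)=w(p)$ for all $p\in D(G_B)\setminus D(G_B[C])$. Then $w_B$ is a weight function for $G_B$, and $\alpha(G_B,w_B)=\alpha(G,w)$.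
   Context: A trigraph $G$ consists of a finite set $V(G)$ and a function $\theta_G:\binom{V(G)}{2}\to\{ -1,0,1\}$; for distinct vertices $u,v$ write $uv$ for $\{u,v\}$; it is strongly adjacent if $\theta_G(uv)=1$, semi-adjacent if $\theta_G(uv)=0$, strongly anti-adjacent if $\theta_G(uv)=-1$; $u,v$ are anti-adjacent if $\theta_G(uv)\le 0$. A stable set is a set of pairwise anti-adjacent vertices. $G[X]$ is the trigraph on $X$ with $\theta_G$ restricted. A cut-partition of $G$ is a partition $(A,B,C)$ of $V(G)$ with $A,B$ non-empty such that every vertex of $A$ is strongly anti-adjacent to every vertex of $B$. Let $D(G)=V(G)\cup\{(u,v): u,v\in V(G),u\neq v\}\cup\binom{V(G)}{2}$. A weight function for $G$ is a map $w:D(G)\to\mathbb{N}$ such that for all distinct $u,v$: if $uv$ is not semi-adjacent then $w(u,v)=w(v,u)=w(uv)=0$, and $w(u,v)\le w(uv)$. A weighted trigraph is a pair $(G,w)$; for a trigraph $H$ obtained from an induced subtrigraph by turning strongly anti-adjacent pairs into semi-adjacent ones, $(H,w)$ means $w$ restricted to $D(H)$ (which is a weight function for $H$). For $S\subseteq V(G)$, $\mathrm{wt}_{(G,w)}(S)=\sum_{u\in S}w(u)+\sum_{u\in S}\sum_{v\in V(G)\setminus S}w(u,v)+\sum_{uv\in\binom{V(G)\setminus S}{2}}w(uv)$, and $\alpha(G,w)=\max\{\mathrm{wt}_{(G,w)}(S): S\text{ stable in }G\}$. For $R\subseteq V(G)$, $\mathrm{Red}[G,w;R]$ is the weighted trigraph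 $(G[R],w')$ where $w'(u)=\max\{w(u)-\sum_{v\in V(G)\setminus R}(w(uv)-w(u,v)),0\}$ for $u\in R$, and $w'(u,v)=w(u,v)$, $w'(uv)=w(uv)$ for distinct $u,v\in R$; and $\mathrm{Ext}[G,w;R]=\sum_{uv\in\binom{V(G)\setminus R}{2}}w(uv)+\sum_{u\in R}\sum_{v\in V(G)\setminus R}w(uv)$. -}

module Defs where

open import Data.Nat using (ℕ; zero; suc; _+_; _∸_; _⊔_; _≤_; _<ᵇ_)
open import Data.Fin using (Fin; zero; suc; toℕ; _≟_)
open import Data.Bool using (Bool; true; false; _∧_; _∨_; not; if_then_else_)
open import Data.List using (List; []; _∷_; foldr; concatMap)
open import Data.Product using (_×_; ∃)
open import Data.Sum using (_⊎_)
open import Relation.Nullary using (¬_)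
open import Relation.Nullary.Decidable using (⌊_⌋)
open import Relation.Binary.PropositionalEquality using (_≡_; _≢_)
import Data.Vec.Functional as VF

-- The ambient vertex type is Fin n; a trigraph "on X" is
-- given by a vertex set X : Fin n → Bool together with the adjacency
-- function θ (only its values on pairs of distinct vertices of X matter).
-- θ u v is meant to be symmetric (θ is a function on unordered pairs).

data Adj : Set where
  strong : Adj   -- θ = 1
  semi   : Adj   -- θ = 0
  anti   : Adj   -- θ = -1

isStrong : Adj → Bool
isStrong strong = true
isStrong semi   = false
isStrong anti   = false

Adjacency : ℕ → Set
Adjacency n = Fin n → Fin n → Adj

Symmetric : ∀ {n} → Adjacency n → Set
Symmetric θ = ∀ u v → θ u v ≡ θ v u

_==_ : ∀ {n} → Fin n → Fin n → Bool
u == v = ⌊ u ≟ v ⌋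

-- Weights: w(u), w(u,v) (ordered pairs), w(uv) (unordered pairs, encoded
-- as a function on ordered pairs required to be symmetric).

record Weight (n : ℕ) : Set where
  field
    wv : Fin n → ℕ
    wo : Fin n → Fin n → ℕ
    wu : Fin n → Fin n → ℕ
open Weight public

IsWeightFunction : ∀ {n} → (Fin n → Bool) → Adjacency n → Weight n → Set
IsWeightFunction X θ w =
  ∀ u v → X u ≡ true → X v ≡ true → u ≢ v →
    (θ u v ≢ semi → (wo w u v ≡ 0 × wo w v u ≡ 0 × wu w u v ≡ 0))
    × wo w u v ≤ wu w u v
    × wu w u v ≡ wu w v u

∑ : ∀ {n} → (Fin n → ℕ) → ℕ
∑ {zero}  f = 0
∑ {suc n} f = f zero + ∑ (λ i → f (suc i))

∑∈ : ∀ {n} → (Fin n → Bool) → (Fin n → ℕ) → ℕ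
∑∈ S f = ∑ (λ u → if S u then f u else 0)

∑pairs∈ : ∀ {n} → (Fin n → Bool) → (Fin n → Fin n → ℕ) → ℕ
∑pairs∈ S f = ∑ (λ u → ∑ (λ v →
  if S u ∧ S v ∧ (toℕ u <ᵇ toℕ v) then f u v else 0))

allF : ∀ {n} → (Fin n → Bool) → Bool
allF {zero}  p = true
allF {suc n} p = p zero ∧ allF (λ i → p (suc i))

_∖_ : ∀ {n} → (Fin n → Bool) → (Fin n → Bool) → (Fin n → Bool)
(X ∖ S) u = X u ∧ not (S u)

subsets : ∀ n → List (Fin n → Bool)
subsets zero    = (λ ()) ∷ []
subsets (suc n) = concatMap (λ S → (false VF.∷ S) ∷ (true VF.∷ S) ∷ []) (subsets n)

isStable : ∀ {n} → (Fin n → Bool) → Adjacency n → (Fin n → Bool) → Bool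
isStable X θ S =
  allF (λ u → not (S u) ∨ X u) ∧
  allF (λ u → allF (λ v → not (S u) ∨ not (S v) ∨ (u == v) ∨ not (isStrong (θ u v))))

wt : ∀ {n} → (Fin n → Bool) → Weight n → (Fin n → Bool) → ℕ
wt X w S =
  ∑∈ S (wv w)
  + ∑∈ S (λ u → ∑∈ (X ∖ S) (λ v → wo w u v))
  + ∑pairs∈ (X ∖ S) (wu w)

-- α(G,w): maximum of wt over stable sets (the empty set is always stable)
α : ∀ {n} → (Fin n → Bool) → Adjacency n → Weight n → ℕ
α {n} X θ w = foldr (λ S acc → if isStable X θ S then wt X w S ⊔ acc else acc) 0 (subsets n)

-- weight of Red[G,w;R]; its trigraph is (R, θ)
redW : ∀ {n} → (Fin n → Bool) → Weight n → (Fin n → Bool) → Weight n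
redW X w R = record
  { wv = λ u → wv w u ∸ ∑∈ (X ∖ R) (λ v → wu w u v ∸ wo w u v)
  ; wo = wo w
  ; wu = wu w
  }

Ext : ∀ {n} → (Fin n → Bool) → Weight n → (Fin n → Bool) → ℕ
Ext X w R = ∑pairs∈ (X ∖ R) (wu w) + ∑∈ R (λ u → ∑∈ (X ∖ R) (λ v → wu w u v))

αRedExt : ∀ {n} → (Fin n → Bool) → Adjacency n → Weight n → (Fin n → Bool) → ℕ
αRedExt X θ w R = α R θ (redW X w R) + Ext X w R

data Side : Set where
  inA inB inC : Side

_==S_ : Side → Side → Bool
inA ==S inA = true
inB ==S inB = true
inC ==S inC = true
_   ==S _   = false

module CutSetup {n : ℕ} (θ : Adjacency n) (w : Weight n)
                (side : Fin n → Side) (c₁ c₂ : Fin n) where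

  A B C : Fin n → Bool
  A u = side u ==S inA
  B u = side u ==S inB
  C u = side u ==S inC

  isC₁C₂ : Fin n → Fin n → Bool
  isC₁C₂ u v = ((u == c₁) ∧ (v == c₂)) ∨ ((u == c₂) ∧ (v == c₁))

  θ' : Adjacency n
  θ' u v = if isC₁C₂ u v then semi else θ u v

  AC BC : Fin n → Bool
  AC u = A u ∨ C u
  BC u = B u ∨ C u

  α[_] : (Fin n → Bool) → ℕ
  α[ C' ] = αRedExt AC θ' w (λ u → A u ∨ C' u)

  αA αAc₁ αAc₂ αAC : ℕ
  αA   = α[ (λ _ → false) ]
  αAc₁ = α[ (λ u → u == c₁) ]
  αAc₂ = α[ (λ u → u == c₂) ]
  αAC  = α[ C ]

  wB : Weight n
  wB = record
    { wv = λ u → if u == c₁ then αAC ∸ wv w c₂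
                 else if u == c₂ then wv w c₂ else wv w u
    ; wo = λ u v → if (u == c₁) ∧ (v == c₂) then (αAc₁ + wv w c₂) ∸ αAC
                   else if (u == c₂) ∧ (v == c₁) then αAc₂ ∸ wv w c₂
                   else wo w u v
    ; wu = λ u v → if isC₁C₂ u v then αA else wu w u v
    }

record IsCutPartition {n : ℕ} (θ : Adjacency n) (side : Fin n → Side) (c₁ c₂ : Fin n) : Set where
  field
    c₁≢c₂    : c₁ ≢ c₂
    C-def    : ∀ u → side u ≡ inC → (u ≡ c₁ ⊎ u ≡ c₂)
    c₁∈C     : side c₁ ≡ inC
    c₂∈C     : side c₂ ≡ inC
    A-nonempty : ∃ (λ (u : Fin n) → side u ≡ inA)
    B-nonempty : ∃ (λ (u : Fin n) → side u ≡ inB)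
    A-B-anti : ∀ u v → side u ≡ inA → side v ≡ inB → θ u v ≡ anti
    C-stable : θ c₁ c₂ ≢ strong

-- There is no weight between A and B, so for every set S of vertices of G
--   wt_G(S) + wt_C(S ∩ C) = wt_{G_A}(S ∩ (A ∪ C)) + wt_{G_B}(S ∩ (B ∪ C)),
-- and replacing w by w_B, which differs from w only inside C, changes wt_{G_B} exactly as much
-- as it changes wt_C.  Red and Ext are designed so that α_{A∪C'} is the largest wt_{G_A}(S) over
-- the stable sets S ⊆ A ∪ C', and w_B is chosen so that wt_{(C,w_B)}(C') = α_{A∪C'} for each of
-- the four C' ⊆ C.  Hence every stable set of G weighs at most its trace on B ∪ C in (G_B, w_B).
-- Conversely, a stable set T of G_B is glued to a maximiser S' ⊆ A ∪ (T ∩ C) for α_{A∪(T∩C)}.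
-- S' may miss some vertices of T ∩ C; dropping them from T does not lower the weight on the pairs
-- between B and C, because w(u,v) ≤ w(uv).  The same deletion argument applied to c₁ or c₂ gives
-- the inequalities between the α's that make w_B a weight function.

module Submission where

open import Defs
open import Data.Nat using (ℕ; zero; suc; _+_; _∸_; _⊔_; _≤_; _<_; _<ᵇ_; _≤ᵇ_; z≤n)
open import Data.Nat.Properties hiding (_≟_)
open import Data.Fin using (Fin; zero; suc; toℕ; _≟_; punchIn)
open import Data.Fin.Properties using (toℕ-injective; punchInᵢ≢i)
open import Data.Bool using (Bool; true; false; _∧_; _∨_; not; if_then_else_)
open import Data.Bool.Properties
  using (T-≡; ⇔→≡; ¬-not; ∨-comm; ∧-comm; ∨-zeroʳ; ∧-zeroʳ; ∨-identityʳ; ∧-identityʳ; ∧-distribʳ-∨; ∧-distribˡ-∨)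
open import Data.Product using (_×_; _,_; proj₁; proj₂; Σ-syntax)
open import Data.Sum using (_⊎_; inj₁; inj₂)
open import Data.List using (List; []; _∷_; foldr)
open import Data.List.Relation.Unary.Any as Any using (Any; here; there)
open import Data.List.Relation.Unary.Any.Properties using (concatMap⁺)
import Data.Vec.Functional as VF
open import Function using (_∘_; id; Equivalence; mk⇔)
open import Relation.Nullary using (¬_; yes; no; contradiction)
open import Relation.Binary.PropositionalEquality
open import Relation.Binary using (tri<; tri≈; tri>)
open import Algebra.Properties.CommutativeMonoid.Sum +-0-commutativeMonoid
  using (sum; sum-cong-≗; ∑-distrib-+; ∑-comm; sum-remove; sum-replicate-zero)
open import Data.Nat.Tactic.RingSolver using (solve-∀)

∑≗sum : ∀ {n} (f : Fin n → ℕ) → ∑ f ≡ sum f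
∑≗sum {zero}  f = refl
∑≗sum {suc n} f = cong (f zero +_) (∑≗sum (f ∘ suc))

∑-cong : ∀ {n} {f g : Fin n → ℕ} → (∀ u → f u ≡ g u) → ∑ f ≡ ∑ g
∑-cong {f = f} {g} f≗g = trans (∑≗sum f) (trans (sum-cong-≗ f≗g) (sym (∑≗sum g)))

∑-mono : ∀ {n} {f g : Fin n → ℕ} → (∀ u → f u ≤ g u) → ∑ f ≤ ∑ g
∑-mono {zero}  f≤g = z≤n
∑-mono {suc n} f≤g = +-mono-≤ (f≤g zero) (∑-mono (f≤g ∘ suc))

∑-+ : ∀ {n} (f g : Fin n → ℕ) → ∑ (λ u → f u + g u) ≡ ∑ f + ∑ g
∑-+ f g = begin
  ∑ (λ u → f u + g u)    ≡⟨ ∑≗sum (λ u → f u + g u) ⟩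
  sum (λ u → f u + g u)  ≡⟨ ∑-distrib-+ f g ⟩
  sum f + sum g          ≡⟨ sym (cong₂ _+_ (∑≗sum f) (∑≗sum g)) ⟩
  ∑ f + ∑ g              ∎
  where open ≡-Reasoning

∑-swap : ∀ {m k} (f : Fin m → Fin k → ℕ) →
  ∑ (λ u → ∑ (f u)) ≡ ∑ (λ v → ∑ (λ u → f u v))
∑-swap f = begin
  ∑ (λ u → ∑ (f u))                ≡⟨ ∑≗sum (λ u → ∑ (f u)) ⟩
  sum (λ u → ∑ (f u))              ≡⟨ sum-cong-≗ (λ u → ∑≗sum (f u)) ⟩
  sum (λ u → sum (f u))            ≡⟨ ∑-comm f ⟩
  sum (λ v → sum (λ u → f u v))    ≡⟨ sum-cong-≗ (λ v → sym (∑≗sum (λ u → f u v))) ⟩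
  sum (λ v → ∑ (λ u → f u v))      ≡⟨ sym (∑≗sum (λ v → ∑ (λ u → f u v))) ⟩
  ∑ (λ v → ∑ (λ u → f u v))        ∎
  where open ≡-Reasoning

∑-zero : ∀ {n} {f : Fin n → ℕ} → (∀ u → f u ≡ 0) → ∑ f ≡ 0
∑-zero {n} {f} f≗0 = trans (∑-cong f≗0) (trans (∑≗sum {n} (λ _ → 0)) (sum-replicate-zero n))

∑-single : ∀ {n} {f : Fin n → ℕ} (c : Fin n) → (∀ u → u ≢ c → f u ≡ 0) → ∑ f ≡ f c
∑-single {suc n} {f} c off = begin
  ∑ f                          ≡⟨ ∑≗sum f ⟩
  sum f                        ≡⟨ sum-remove f ⟩
  f c + sum (f ∘ punchIn c)    ≡⟨ cong (f c +_) (∑≗sum (f ∘ punchIn c)) ⟨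
  f c + ∑ (f ∘ punchIn c)      ≡⟨ cong (f c +_) (∑-zero (λ j → off _ (punchInᵢ≢i c j))) ⟩
  f c + 0                      ≡⟨ +-identityʳ (f c) ⟩
  f c                          ∎
  where open ≡-Reasoning

module _ {n : ℕ} {u v : Fin n} where

  ==-≡ : u ≡ v → (u == v) ≡ true
  ==-≡ u≡v with u ≟ v
  ... | yes _   = refl
  ... | no  u≢v = contradiction u≡v u≢v

  ==-≢ : u ≢ v → (u == v) ≡ false
  ==-≢ u≢v with u ≟ v
  ... | yes u≡v = contradiction u≡v u≢v
  ... | no  _   = refl

  ==⇒≡ : (u == v) ≡ true → u ≡ v
  ==⇒≡ u==v with u ≟ v
  ... | yes u≡v = u≡v

VSet : ℕ → Set
VSet n = Fin n → Bool

module _ {n : ℕ} where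

  ∅ : VSet n
  ∅ _ = false

  ｛_｝ : Fin n → VSet n
  ｛ c ｝ u = u == c

  _∪_ _∩_ : VSet n → VSet n → VSet n
  (X ∪ Y) u = X u ∨ Y u
  (X ∩ Y) u = X u ∧ Y u

  _⊆_ _≐_ Disjoint : VSet n → VSet n → Set
  X ⊆ Y = ∀ u → X u ≡ true → Y u ≡ true
  X ≐ Y = ∀ u → X u ≡ Y u
  Disjoint X Y = ∀ u → X u ≡ true → Y u ≡ false

  infixr 6 _∪_
  infixr 7 _∩_
  infix 4 _⊆_ _≐_

  ⊆-trans : ∀ {X Y Z : VSet n} → X ⊆ Y → Y ⊆ Z → X ⊆ Z
  ⊆-trans X⊆Y Y⊆Z u = Y⊆Z u ∘ X⊆Y u

  ∩-⊆ˡ : ∀ (S P : VSet n) → S ∩ P ⊆ S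
  ∩-⊆ˡ S P u SPu with S u
  ... | true = refl

  ∩-⊆ʳ : ∀ (S P : VSet n) → S ∩ P ⊆ P
  ∩-⊆ʳ S P u SPu with S u
  ... | true = SPu

  ∖-⊆ : ∀ (P S : VSet n) → P ∖ S ⊆ P
  ∖-⊆ P S u P∖Su with P u
  ... | true = refl

  ∖-self : ∀ (S : VSet n) → S ∖ S ⊆ ∅
  ∖-self S u S∖Su with S u
  ... | true  = S∖Su
  ... | false = S∖Su

  disjoint-sym : ∀ {X Y : VSet n} → Disjoint X Y → Disjoint Y X
  disjoint-sym {X} X∩Y≡∅ u Yu with X u in Xu
  ... | true  = contradiction (trans (sym Yu) (X∩Y≡∅ u Xu)) λ ()
  ... | false = refl

  disjoint⇒≢ : ∀ {X Y : VSet n} {u v} → Disjoint X Y → X u ≡ true → Y v ≡ true → u ≢ v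
  disjoint⇒≢ {u = u} X∩Y≡∅ Xu Yv refl = contradiction (trans (sym Yv) (X∩Y≡∅ u Xu)) λ ()

if-cong : ∀ {b b'} {x y : ℕ} → b ≡ b' → (b ≡ true → x ≡ y) →
  (if b then x else 0) ≡ (if b' then y else 0)
if-cong {true}  refl x≡y = x≡y refl
if-cong {false} refl _   = refl

if-∑ : ∀ {n} b (g : Fin n → ℕ) → (if b then ∑ g else 0) ≡ ∑ (λ v → if b then g v else 0)
if-∑ true  g = refl
if-∑ false g = sym (∑-zero {f = λ v → if false then g v else 0} (λ _ → refl))

module _ {n : ℕ} where

  ∑∈-cong : ∀ {S S' : VSet n} {f g : Fin n → ℕ} → S ≐ S' → (∀ u → S u ≡ true → f u ≡ g u) →
    ∑∈ S f ≡ ∑∈ S' g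
  ∑∈-cong S≐S' f≗g = ∑-cong (λ u → if-cong (S≐S' u) (f≗g u))

  ∑∈-congˡ : ∀ {S S' : VSet n} (f : Fin n → ℕ) → S ≐ S' → ∑∈ S f ≡ ∑∈ S' f
  ∑∈-congˡ f S≐S' = ∑∈-cong S≐S' (λ _ _ → refl)

  ∑∈-congʳ : ∀ (S : VSet n) {f g : Fin n → ℕ} → (∀ u → S u ≡ true → f u ≡ g u) → ∑∈ S f ≡ ∑∈ S g
  ∑∈-congʳ S = ∑∈-cong (λ _ → refl)

  ∑∈-mono : ∀ (S : VSet n) {f g : Fin n → ℕ} → (∀ u → S u ≡ true → f u ≤ g u) → ∑∈ S f ≤ ∑∈ S g
  ∑∈-mono S f≤g = ∑-mono pointwise
    where
    pointwise : ∀ u → (if S u then _ else 0) ≤ (if S u then _ else 0)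
    pointwise u with S u in Su
    ... | true  = f≤g u Su
    ... | false = z≤n

  ∑∈-mono-⊆ : ∀ {S S' : VSet n} (f : Fin n → ℕ) → S ⊆ S' → ∑∈ S f ≤ ∑∈ S' f
  ∑∈-mono-⊆ {S} {S'} f S⊆S' = ∑-mono pointwise
    where
    pointwise : ∀ u → (if S u then _ else 0) ≤ (if S' u then _ else 0)
    pointwise u with S u in Su
    ... | true  rewrite S⊆S' u Su = ≤-refl
    ... | false = z≤n

  ∑∈-vanish : ∀ (S : VSet n) (f : Fin n → ℕ) → (∀ u → S u ≡ true → f u ≡ 0) → ∑∈ S f ≡ 0
  ∑∈-vanish S f f≗0 = ∑-zero pointwise
    where
    pointwise : ∀ u → (if S u then _ else 0) ≡ 0
    pointwise u with S u in Su
    ... | true  = f≗0 u Su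
    ... | false = refl

  ∑∈-+ : ∀ (S : VSet n) (f g : Fin n → ℕ) → ∑∈ S (λ u → f u + g u) ≡ ∑∈ S f + ∑∈ S g
  ∑∈-+ S f g =
    trans (∑-cong pointwise) (∑-+ (λ u → if S u then f u else 0) (λ u → if S u then g u else 0))
    where
    pointwise : ∀ u → (if S u then f u + g u else 0) ≡ (if S u then f u else 0) + (if S u then g u else 0)
    pointwise u with S u
    ... | true  = refl
    ... | false = refl

  ∑∈-∪ : ∀ {A B : VSet n} (f : Fin n → ℕ) → Disjoint A B → ∑∈ (A ∪ B) f ≡ ∑∈ A f + ∑∈ B f
  ∑∈-∪ {A} {B} f A∩B≡∅ =
    trans (∑-cong pointwise) (∑-+ (λ u → if A u then f u else 0) (λ u → if B u then f u else 0))
    where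
    pointwise : ∀ u → (if A u ∨ B u then f u else 0) ≡ (if A u then f u else 0) + (if B u then f u else 0)
    pointwise u with A u in Au
    ... | true  rewrite A∩B≡∅ u Au = sym (+-identityʳ (f u))
    ... | false = refl

  ∑∈-∪-vanishˡ : ∀ {A B : VSet n} (f : Fin n → ℕ) → Disjoint A B → (∀ u → A u ≡ true → f u ≡ 0) →
    ∑∈ (A ∪ B) f ≡ ∑∈ B f
  ∑∈-∪-vanishˡ {A} {B} f A∩B≡∅ f≗0 = trans (∑∈-∪ f A∩B≡∅) (cong (_+ ∑∈ B f) (∑∈-vanish A f f≗0))

  ∑∈-｛｝ : ∀ {S : VSet n} (f : Fin n → ℕ) {c} → S ≐ ｛ c ｝ → ∑∈ S f ≡ f c
  ∑∈-｛｝ {S} f {c} S≐c = trans (∑-single c off) (if-cong (trans (S≐c c) (==-≡ refl)) (λ _ → refl))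
    where
    off : ∀ u → u ≢ c → (if S u then f u else 0) ≡ 0
    off u u≢c rewrite S≐c u | ==-≢ u≢c = refl

  ∑∈-swap : ∀ (A B : VSet n) (f : Fin n → Fin n → ℕ) →
    ∑∈ A (λ u → ∑∈ B (f u)) ≡ ∑∈ B (λ v → ∑∈ A (λ u → f u v))
  ∑∈-swap A B f = begin
    ∑ (λ u → if A u then ∑ (λ v → if B v then f u v else 0) else 0)
      ≡⟨ ∑-cong (λ u → if-∑ (A u) (λ v → if B v then f u v else 0)) ⟩
    ∑ (λ u → ∑ (λ v → if A u then (if B v then f u v else 0) else 0))
      ≡⟨ ∑-swap (λ u v → if A u then (if B v then f u v else 0) else 0) ⟩
    ∑ (λ v → ∑ (λ u → if A u then (if B v then f u v else 0) else 0))
      ≡⟨ ∑-cong (λ v → ∑-cong (λ u → if-comm (A u) (B v))) ⟩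
    ∑ (λ v → ∑ (λ u → if B v then (if A u then f u v else 0) else 0))
      ≡⟨ ∑-cong (λ v → sym (if-∑ (B v) (λ u → if A u then f u v else 0))) ⟩
    ∑ (λ v → if B v then ∑ (λ u → if A u then f u v else 0) else 0) ∎
    where
    open ≡-Reasoning
    if-comm : ∀ a b {x : ℕ} → (if a then (if b then x else 0) else 0) ≡ (if b then (if a then x else 0) else 0)
    if-comm true  true  = refl
    if-comm true  false = refl
    if-comm false true  = refl
    if-comm false false = refl

  ∑∈²-∪ : ∀ {A B C D : VSet n} (f : Fin n → Fin n → ℕ) → Disjoint A B → Disjoint C D →
    ∑∈ (A ∪ B) (λ u → ∑∈ (C ∪ D) (f u))
      ≡ (∑∈ A (λ u → ∑∈ C (f u)) + ∑∈ A (λ u → ∑∈ D (f u)))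
      + (∑∈ B (λ u → ∑∈ C (f u)) + ∑∈ B (λ u → ∑∈ D (f u)))
  ∑∈²-∪ {A} {B} {C} {D} f A∩B≡∅ C∩D≡∅ = begin
    ∑∈ (A ∪ B) (λ u → ∑∈ (C ∪ D) (f u))
      ≡⟨ ∑∈-congʳ (A ∪ B) (λ u _ → ∑∈-∪ (f u) C∩D≡∅) ⟩
    ∑∈ (A ∪ B) (λ u → ∑∈ C (f u) + ∑∈ D (f u))
      ≡⟨ ∑∈-∪ (λ u → ∑∈ C (f u) + ∑∈ D (f u)) A∩B≡∅ ⟩
    ∑∈ A (λ u → ∑∈ C (f u) + ∑∈ D (f u)) + ∑∈ B (λ u → ∑∈ C (f u) + ∑∈ D (f u))
      ≡⟨ cong₂ _+_ (∑∈-+ A (λ u → ∑∈ C (f u)) (λ u → ∑∈ D (f u)))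
                   (∑∈-+ B (λ u → ∑∈ C (f u)) (λ u → ∑∈ D (f u))) ⟩
    (∑∈ A (λ u → ∑∈ C (f u)) + ∑∈ A (λ u → ∑∈ D (f u)))
      + (∑∈ B (λ u → ∑∈ C (f u)) + ∑∈ B (λ u → ∑∈ D (f u))) ∎
    where open ≡-Reasoning

<ᵇ-true : ∀ {m k} → m < k → (m <ᵇ k) ≡ true
<ᵇ-true m<k = Equivalence.to T-≡ (<⇒<ᵇ m<k)

<ᵇ-false : ∀ {m k} → ¬ m < k → (m <ᵇ k) ≡ false
<ᵇ-false {m} {k} m≮k with m <ᵇ k in m<ᵇk
... | true  = contradiction (<ᵇ⇒< m k (Equivalence.from T-≡ m<ᵇk)) m≮k
... | false = refl

≤ᵇ-true⇒≤ : ∀ {m k} → (m ≤ᵇ k) ≡ true → m ≤ k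
≤ᵇ-true⇒≤ {m} {k} m≤ᵇk = ≤ᵇ⇒≤ m k (Equivalence.from T-≡ m≤ᵇk)

≤ᵇ-false⇒> : ∀ {m k} → (m ≤ᵇ k) ≡ false → k < m
≤ᵇ-false⇒> m≰ᵇk = ≰⇒> (λ m≤k → contradiction (trans (sym m≰ᵇk) (Equivalence.to T-≡ (≤⇒≤ᵇ m≤k))) λ ())

ordered : ∀ {n} → (Fin n → Fin n → ℕ) → Fin n → Fin n → ℕ
ordered f u v = if toℕ u <ᵇ toℕ v then f u v else 0

ordered-diag : ∀ {n} (f : Fin n → Fin n → ℕ) u → ordered f u u ≡ 0
ordered-diag f u rewrite <ᵇ-false (n≮n (toℕ u)) = refl

ordered-split : ∀ {n} (f : Fin n → Fin n → ℕ) {u v} → u ≢ v → f v u ≡ f u v →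
  ordered f u v + ordered f v u ≡ f u v
ordered-split f {u} {v} u≢v fvu≡fuv with <-cmp (toℕ u) (toℕ v)
... | tri< u<v _ v≮u rewrite <ᵇ-true u<v | <ᵇ-false v≮u = +-identityʳ (f u v)
... | tri≈ _ u≡v _   = contradiction (toℕ-injective u≡v) u≢v
... | tri> u≮v _ v<u rewrite <ᵇ-false u≮v | <ᵇ-true v<u = fvu≡fuv

module _ {n : ℕ} where

  ∑pairs∈-as-∑∈ : ∀ (S : VSet n) f → ∑pairs∈ S f ≡ ∑∈ S (λ u → ∑∈ S (ordered f u))
  ∑pairs∈-as-∑∈ S f = ∑-cong λ u →
    trans (∑-cong (pointwise u)) (sym (if-∑ (S u) (λ v → if S v then ordered f u v else 0)))
    where
    pointwise : ∀ u v → (if S u ∧ S v ∧ (toℕ u <ᵇ toℕ v) then f u v else 0)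
                      ≡ (if S u then (if S v then ordered f u v else 0) else 0)
    pointwise u v with S u | S v
    ... | true  | true  = refl
    ... | true  | false = refl
    ... | false | _     = refl

  ∑pairs∈-∪ : ∀ {A B : VSet n} (f : Fin n → Fin n → ℕ) → Disjoint A B →
    (∀ u v → A u ≡ true → B v ≡ true → f v u ≡ f u v) →
    ∑pairs∈ (A ∪ B) f ≡ (∑pairs∈ A f + ∑pairs∈ B f) + ∑∈ A (λ u → ∑∈ B (f u))
  ∑pairs∈-∪ {A} {B} f A∩B≡∅ f-sym = begin
    ∑pairs∈ (A ∪ B) f
      ≡⟨ ∑pairs∈-as-∑∈ (A ∪ B) f ⟩
    ∑∈ (A ∪ B) (λ u → ∑∈ (A ∪ B) (g u))
      ≡⟨ ∑∈²-∪ g A∩B≡∅ A∩B≡∅ ⟩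
    (within A + across) + (∑∈ B (λ u → ∑∈ A (g u)) + within B)
      ≡⟨ cong (λ x → (within A + across) + (x + within B)) (∑∈-swap B A g) ⟩
    (within A + across) + (across′ + within B)
      ≡⟨ regroup (within A) across across′ (within B) ⟩
    (within A + within B) + (across + across′)
      ≡⟨ cong₂ _+_ (sym (cong₂ _+_ (∑pairs∈-as-∑∈ A f) (∑pairs∈-as-∑∈ B f))) both-orders ⟩
    (∑pairs∈ A f + ∑pairs∈ B f) + ∑∈ A (λ u → ∑∈ B (f u)) ∎
    where
    open ≡-Reasoning
    g = ordered f
    within : VSet n → ℕ
    within P = ∑∈ P (λ u → ∑∈ P (g u))
    across across′ : ℕ
    across  = ∑∈ A (λ u → ∑∈ B (g u))
    across′ = ∑∈ A (λ u → ∑∈ B (λ v → g v u))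
    regroup : ∀ a b c d → (a + b) + (c + d) ≡ (a + d) + (b + c)
    regroup = solve-∀
    both-orders : across + across′ ≡ ∑∈ A (λ u → ∑∈ B (f u))
    both-orders = begin
      across + across′
        ≡⟨ sym (∑∈-+ A (λ u → ∑∈ B (g u)) (λ u → ∑∈ B (λ v → g v u))) ⟩
      ∑∈ A (λ u → ∑∈ B (g u) + ∑∈ B (λ v → g v u))
        ≡⟨ ∑∈-congʳ A (λ u _ → sym (∑∈-+ B (g u) (λ v → g v u))) ⟩
      ∑∈ A (λ u → ∑∈ B (λ v → g u v + g v u))
        ≡⟨ ∑∈-congʳ A (λ u Au → ∑∈-congʳ B (λ v Bv →
             ordered-split f (disjoint⇒≢ A∩B≡∅ Au Bv) (f-sym u v Au Bv))) ⟩
      ∑∈ A (λ u → ∑∈ B (f u)) ∎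

  ∑pairs∈-cong : ∀ {S S' : VSet n} (f : Fin n → Fin n → ℕ) → S ≐ S' → ∑pairs∈ S f ≡ ∑pairs∈ S' f
  ∑pairs∈-cong {S} {S'} f S≐S' = begin
    ∑pairs∈ S f                             ≡⟨ ∑pairs∈-as-∑∈ S f ⟩
    ∑∈ S (λ u → ∑∈ S (ordered f u))         ≡⟨ ∑∈-cong S≐S' (λ u _ → ∑∈-congˡ (ordered f u) S≐S') ⟩
    ∑∈ S' (λ u → ∑∈ S' (ordered f u))       ≡⟨ sym (∑pairs∈-as-∑∈ S' f) ⟩
    ∑pairs∈ S' f                            ∎
    where open ≡-Reasoning

  ∑pairs∈-congʳ : ∀ (S : VSet n) {f g : Fin n → Fin n → ℕ} →
    (∀ u v → S u ≡ true → S v ≡ true → f u v ≡ g u v) → ∑pairs∈ S f ≡ ∑pairs∈ S g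
  ∑pairs∈-congʳ S {f} {g} f≗g = begin
    ∑pairs∈ S f                         ≡⟨ ∑pairs∈-as-∑∈ S f ⟩
    ∑∈ S (λ u → ∑∈ S (ordered f u))     ≡⟨ ∑∈-congʳ S (λ u Su → ∑∈-congʳ S (λ v Sv →
                                             cong (λ x → if toℕ u <ᵇ toℕ v then x else 0) (f≗g u v Su Sv))) ⟩
    ∑∈ S (λ u → ∑∈ S (ordered g u))     ≡⟨ sym (∑pairs∈-as-∑∈ S g) ⟩
    ∑pairs∈ S g                         ∎
    where open ≡-Reasoning

module _ {n : ℕ} {Y Z S : VSet n} where

  ∩-cover : S ⊆ Y ∪ Z → S ≐ (S ∩ Y) ∪ (S ∩ Z)
  ∩-cover S⊆Y∪Z u with S u in Su
  ... | true  = sym (S⊆Y∪Z u Su)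
  ... | false = refl

  ∩-disjoint : Disjoint Y Z → Disjoint (S ∩ Y) (S ∩ Z)
  ∩-disjoint Y∩Z≡∅ u SYu with S u | Y u in Yu
  ... | true | true = Y∩Z≡∅ u Yu

  ∖-∪ : (Y ∪ Z) ∖ S ≐ (Y ∖ S) ∪ (Z ∖ S)
  ∖-∪ u = ∧-distribʳ-∨ (not (S u)) (Y u) (Z u)

  ∖-disjoint : Disjoint Y Z → Disjoint (Y ∖ S) (Z ∖ S)
  ∖-disjoint Y∩Z≡∅ u Y∖Su with Y u in Yu
  ... | true rewrite Y∩Z≡∅ u Yu = refl

module _ {n : ℕ} {Y S : VSet n} where

  ∩-absorb : ∀ {P} → P ⊆ Y → (S ∩ Y) ∩ P ≐ S ∩ P
  ∩-absorb {P} P⊆Y u with P u in Pu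
  ... | true  rewrite P⊆Y u Pu = ∧-identityʳ (S u ∧ true)
  ... | false = trans (∧-zeroʳ (S u ∧ Y u)) (sym (∧-zeroʳ (S u)))

  ∖-∩ : Y ∖ (S ∩ Y) ≐ Y ∖ S
  ∖-∩ u with Y u | S u
  ... | true  | true  = refl
  ... | true  | false = refl
  ... | false | _     = refl

-- Splitting wt along a partition of the vertex set

record WeightLaws {n} (w : Weight n) : Set where
  field
    wo≤wu  : ∀ u v → u ≢ v → wo w u v ≤ wu w u v
    wu-sym : ∀ u v → u ≢ v → wu w u v ≡ wu w v u
open WeightLaws public

module _ {n : ℕ} where

  edgeWt : VSet n → Weight n → VSet n → ℕ
  edgeWt X w S = ∑∈ S (λ u → ∑∈ (X ∖ S) (wo w u)) + ∑pairs∈ (X ∖ S) (wu w)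

  wt-split : ∀ X w (S : VSet n) → wt X w S ≡ ∑∈ S (wv w) + edgeWt X w S
  wt-split X w S = +-assoc (∑∈ S (wv w)) (∑∈ S (λ u → ∑∈ (X ∖ S) (wo w u))) (∑pairs∈ (X ∖ S) (wu w))

  edgeWt-cong : ∀ {X X' S S' : VSet n} w → X ≐ X' → S ≐ S' → edgeWt X w S ≡ edgeWt X' w S'
  edgeWt-cong w X≐X' S≐S' =
    cong₂ _+_ (∑∈-cong S≐S' (λ u _ → ∑∈-congˡ (wo w u) X∖S≐X'∖S')) (∑pairs∈-cong (wu w) X∖S≐X'∖S')
    where
    X∖S≐X'∖S' = λ u → cong₂ (λ x s → x ∧ not s) (X≐X' u) (S≐S' u)

  wt-cong : ∀ {X X' S S' : VSet n} w → X ≐ X' → S ≐ S' → wt X w S ≡ wt X' w S'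
  wt-cong {X} {X'} {S} {S'} w X≐X' S≐S' = begin
    wt X w S                           ≡⟨ wt-split X w S ⟩
    ∑∈ S (wv w) + edgeWt X w S         ≡⟨ cong₂ _+_ (∑∈-congˡ (wv w) S≐S') (edgeWt-cong w X≐X' S≐S') ⟩
    ∑∈ S' (wv w) + edgeWt X' w S'      ≡⟨ sym (wt-split X' w S') ⟩
    wt X' w S'                         ∎
    where open ≡-Reasoning

  wt-congˢ : ∀ X w {S S' : VSet n} → S ≐ S' → wt X w S ≡ wt X w S'
  wt-congˢ X w = wt-cong {X = X} w (λ _ → refl)

  wt-congˣ : ∀ {X X' : VSet n} w S → X ≐ X' → wt X w S ≡ wt X' w S
  wt-congˣ w S X≐X' = wt-cong {S = S} w X≐X' (λ _ → refl)

  -- the part of wt (Y ∪ Z) w S contributed by the pairs meeting both Y and Z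
  cross : VSet n → VSet n → Weight n → VSet n → ℕ
  cross Y Z w S = (∑∈ (S ∩ Y) (λ u → ∑∈ (Z ∖ S) (wo w u)) + ∑∈ (S ∩ Z) (λ u → ∑∈ (Y ∖ S) (wo w u)))
                + ∑∈ (Y ∖ S) (λ u → ∑∈ (Z ∖ S) (wu w u))

  wt-∪ : ∀ {Y Z S : VSet n} {w} → WeightLaws w → Disjoint Y Z → S ⊆ Y ∪ Z →
    wt (Y ∪ Z) w S ≡ (wt Y w (S ∩ Y) + wt Z w (S ∩ Z)) + cross Y Z w S
  wt-∪ {Y} {Z} {S} {w} laws Y∩Z≡∅ S⊆Y∪Z = begin
    wt (Y ∪ Z) w S
      ≡⟨ cong₂ (λ a b → a + b + ∑pairs∈ ((Y ∪ Z) ∖ S) (wu w)) vertices outgoing ⟩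
    (vY + vZ) + ((oYY + oYZ) + (oZY + oZZ)) + ∑pairs∈ ((Y ∪ Z) ∖ S) (wu w)
      ≡⟨ cong ((vY + vZ) + ((oYY + oYZ) + (oZY + oZZ)) +_) pairs ⟩
    (vY + vZ) + ((oYY + oYZ) + (oZY + oZZ)) + ((pY + pZ) + pYZ)
      ≡⟨ regroup vY vZ oYY oYZ oZY oZZ pY pZ pYZ ⟩
    ((vY + oYY + pY) + (vZ + oZZ + pZ)) + ((oYZ + oZY) + pYZ)
      ≡⟨ cong (_+ cross Y Z w S) (cong₂ _+_ (restrict Y) (restrict Z)) ⟨
    (wt Y w (S ∩ Y) + wt Z w (S ∩ Z)) + cross Y Z w S ∎
    where
    open ≡-Reasoning
    out : VSet n → VSet n → ℕ
    out P Q = ∑∈ (S ∩ P) (λ u → ∑∈ (Q ∖ S) (wo w u))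
    vY = ∑∈ (S ∩ Y) (wv w)
    vZ = ∑∈ (S ∩ Z) (wv w)
    oYY = out Y Y
    oYZ = out Y Z
    oZY = out Z Y
    oZZ = out Z Z
    pY = ∑pairs∈ (Y ∖ S) (wu w)
    pZ = ∑pairs∈ (Z ∖ S) (wu w)
    pYZ = ∑∈ (Y ∖ S) (λ u → ∑∈ (Z ∖ S) (wu w u))
    S≐SY∪SZ = ∩-cover S⊆Y∪Z
    Y∖S∩Z∖S≡∅ = ∖-disjoint {S = S} Y∩Z≡∅
    vertices : ∑∈ S (wv w) ≡ vY + vZ
    vertices = trans (∑∈-congˡ (wv w) S≐SY∪SZ) (∑∈-∪ (wv w) (∩-disjoint Y∩Z≡∅))
    outgoing : ∑∈ S (λ u → ∑∈ ((Y ∪ Z) ∖ S) (wo w u)) ≡ (oYY + oYZ) + (oZY + oZZ)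
    outgoing = trans (∑∈-cong S≐SY∪SZ (λ u _ → ∑∈-congˡ (wo w u) (∖-∪ {Y = Y} {Z} {S})))
                     (∑∈²-∪ (wo w) (∩-disjoint Y∩Z≡∅) Y∖S∩Z∖S≡∅)
    pairs : ∑pairs∈ ((Y ∪ Z) ∖ S) (wu w) ≡ (pY + pZ) + pYZ
    pairs = trans (∑pairs∈-cong (wu w) (∖-∪ {Y = Y} {Z} {S}))
      (∑pairs∈-∪ (wu w) Y∖S∩Z∖S≡∅ (λ u v Y∖Su Z∖Sv → sym (wu-sym laws u v (disjoint⇒≢ Y∖S∩Z∖S≡∅ Y∖Su Z∖Sv))))
    restrict : ∀ P → wt P w (S ∩ P) ≡ ∑∈ (S ∩ P) (wv w) + out P P + ∑pairs∈ (P ∖ S) (wu w)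
    restrict P = cong₂ (λ a b → ∑∈ (S ∩ P) (wv w) + a + b)
      (∑∈-congʳ (S ∩ P) (λ u _ → ∑∈-congˡ (wo w u) (∖-∩ {Y = P} {S})))
      (∑pairs∈-cong (wu w) (∖-∩ {Y = P} {S}))
    regroup : ∀ a b c d e f g h i → (a + b) + ((c + d) + (e + f)) + ((g + h) + i)
                                   ≡ ((a + c + g) + (b + f + h)) + ((d + e) + i)
    regroup = solve-∀

-- Removing vertices from a set

module _ {n : ℕ} {Y Z S S' : VSet n} (Y∩Z≡∅ : Disjoint Y Z) (S'⊆S : S' ⊆ S) (S∖S'⊆Z : S ∖ S' ⊆ Z) where

  private
    removed-∈Z : ∀ {u} → S u ≡ true → S' u ≡ false → Z u ≡ true
    removed-∈Z {u} Su S'u = S∖S'⊆Z u (cong₂ (λ s s' → s ∧ not s') Su S'u)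

    kept-on-Y : ∀ {u} → Y u ≡ true → S u ≡ S' u
    kept-on-Y {u} Yu with S u in Su | S' u in S'u
    ... | true  | true  = refl
    ... | false | false = refl
    ... | false | true  = contradiction (trans (sym (S'⊆S u S'u)) Su) λ ()
    ... | true  | false = contradiction (trans (sym (removed-∈Z Su S'u)) (Y∩Z≡∅ u Yu)) λ ()

  ∩Y-agree : S ∩ Y ≐ S' ∩ Y
  ∩Y-agree u with Y u in Yu
  ... | true  = trans (∧-identityʳ (S u)) (trans (kept-on-Y Yu) (sym (∧-identityʳ (S' u))))
  ... | false = trans (∧-zeroʳ (S u)) (sym (∧-zeroʳ (S' u)))

  ∖Y-agree : Y ∖ S ≐ Y ∖ S'
  ∖Y-agree u with Y u in Yu
  ... | true  = cong not (kept-on-Y Yu)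
  ... | false = refl

  ∩Z-grow : S ∩ Z ≐ (S' ∩ Z) ∪ (S ∖ S')
  ∩Z-grow u with S u in Su | S' u in S'u
  ... | true  | true  = sym (∨-identityʳ (Z u))
  ... | true  | false = removed-∈Z Su S'u
  ... | false | true  = contradiction (trans (sym (S'⊆S u S'u)) Su) λ ()
  ... | false | false = refl

  ∖Z-shrink : Z ∖ S' ≐ (Z ∖ S) ∪ (S ∖ S')
  ∖Z-shrink u with S u in Su | S' u in S'u
  ... | true  | true  = sym (∨-identityʳ (Z u ∧ false))
  ... | true  | false rewrite removed-∈Z Su S'u = refl
  ... | false | true  = contradiction (trans (sym (S'⊆S u S'u)) Su) λ ()
  ... | false | false = sym (∨-identityʳ (Z u ∧ true))

  cross-antitone : ∀ {w} → WeightLaws w → cross Y Z w S ≤ cross Y Z w S'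
  cross-antitone {w} laws = begin
    (t₁ S + t₂ S) + t₃ S
      ≡⟨ cong (λ x → (t₁ S + x) + t₃ S) t₂-split ⟩
    (t₁ S + (t₂ S' + lost)) + t₃ S
      ≤⟨ +-monoˡ-≤ (t₃ S) (+-mono-≤ t₁-mono (+-monoʳ-≤ (t₂ S') lost≤gained)) ⟩
    (t₁ S' + (t₂ S' + gained)) + t₃ S
      ≡⟨ shuffle (t₁ S') (t₂ S') gained (t₃ S) ⟩
    (t₁ S' + t₂ S') + (t₃ S + gained)
      ≡⟨ cong ((t₁ S' + t₂ S') +_) t₃-split ⟨
    (t₁ S' + t₂ S') + t₃ S' ∎
    where
    open ≤-Reasoning
    D = S ∖ S'
    t₁ t₂ t₃ : VSet n → ℕ
    t₁ P = ∑∈ (P ∩ Y) (λ u → ∑∈ (Z ∖ P) (wo w u))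
    t₂ P = ∑∈ (P ∩ Z) (λ u → ∑∈ (Y ∖ P) (wo w u))
    t₃ P = ∑∈ (Y ∖ P) (λ u → ∑∈ (Z ∖ P) (wu w u))
    lost gained : ℕ
    lost   = ∑∈ D (λ u → ∑∈ (Y ∖ S') (wo w u))
    gained = ∑∈ (Y ∖ S') (λ u → ∑∈ D (wu w u))
    S'∩Z∩D≡∅ : Disjoint (S' ∩ Z) D
    S'∩Z∩D≡∅ u S'Zu with S' u
    ... | true = ∧-zeroʳ (S u)
    Z∖S∩D≡∅ : Disjoint (Z ∖ S) D
    Z∖S∩D≡∅ u Z∖Su with Z u | S u
    ... | true | false = refl
    t₁-mono : t₁ S ≤ t₁ S'
    t₁-mono = ≤-trans (∑∈-mono (S ∩ Y) (λ u _ → ∑∈-mono-⊆ (wo w u) Z∖S⊆Z∖S'))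
                      (≤-reflexive (∑∈-congˡ (λ u → ∑∈ (Z ∖ S') (wo w u)) ∩Y-agree))
      where
      Z∖S⊆Z∖S' : Z ∖ S ⊆ Z ∖ S'
      Z∖S⊆Z∖S' u Z∖Su = trans (∖Z-shrink u) (cong (_∨ D u) Z∖Su)
    t₂-split : t₂ S ≡ t₂ S' + lost
    t₂-split = begin-equality
      ∑∈ (S ∩ Z) (λ u → ∑∈ (Y ∖ S) (wo w u))
        ≡⟨ ∑∈-cong ∩Z-grow (λ u _ → ∑∈-congˡ (wo w u) ∖Y-agree) ⟩
      ∑∈ ((S' ∩ Z) ∪ D) (λ u → ∑∈ (Y ∖ S') (wo w u))
        ≡⟨ ∑∈-∪ (λ u → ∑∈ (Y ∖ S') (wo w u)) S'∩Z∩D≡∅ ⟩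
      t₂ S' + lost ∎
    t₃-split : t₃ S' ≡ t₃ S + gained
    t₃-split = begin-equality
      ∑∈ (Y ∖ S') (λ u → ∑∈ (Z ∖ S') (wu w u))
        ≡⟨ ∑∈-congʳ (Y ∖ S') (λ u _ → trans (∑∈-congˡ (wu w u) ∖Z-shrink) (∑∈-∪ (wu w u) Z∖S∩D≡∅)) ⟩
      ∑∈ (Y ∖ S') (λ u → ∑∈ (Z ∖ S) (wu w u) + ∑∈ D (wu w u))
        ≡⟨ ∑∈-+ (Y ∖ S') (λ u → ∑∈ (Z ∖ S) (wu w u)) (λ u → ∑∈ D (wu w u)) ⟩
      ∑∈ (Y ∖ S') (λ u → ∑∈ (Z ∖ S) (wu w u)) + gained
        ≡⟨ cong (_+ gained) (∑∈-congˡ (λ u → ∑∈ (Z ∖ S) (wu w u)) ∖Y-agree) ⟨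
      t₃ S + gained ∎
    lost≤gained : lost ≤ gained
    lost≤gained = begin
      lost
        ≤⟨ ∑∈-mono D (λ u Du → ∑∈-mono (Y ∖ S') (λ v Y∖S'v → wo≤wu-flip u v (S∖S'⊆Z u Du) (∖-⊆ Y S' v Y∖S'v))) ⟩
      ∑∈ D (λ u → ∑∈ (Y ∖ S') (λ v → wu w v u))
        ≡⟨ ∑∈-swap D (Y ∖ S') (λ u v → wu w v u) ⟩
      gained ∎
      where
      wo≤wu-flip : ∀ u v → Z u ≡ true → Y v ≡ true → wo w u v ≤ wu w v u
      wo≤wu-flip u v Zu Yv = ≤-trans (wo≤wu laws u v u≢v) (≤-reflexive (wu-sym laws u v u≢v))
        where u≢v = λ u≡v → disjoint⇒≢ Y∩Z≡∅ Yv Zu (sym u≡v)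
    shuffle : ∀ a b c d → (a + (b + c)) + d ≡ (a + b) + (d + c)
    shuffle = solve-∀

module _ {n : ℕ} where

  ∑pairs∈-empty : ∀ {S : VSet n} (f : Fin n → Fin n → ℕ) → (∀ u → S u ≡ false) → ∑pairs∈ S f ≡ 0
  ∑pairs∈-empty {S} f S≡∅ = trans (∑pairs∈-as-∑∈ S f)
    (∑∈-vanish S (λ u → ∑∈ S (ordered f u)) (λ u Su → contradiction (trans (sym Su) (S≡∅ u)) λ ()))

  wt-self : ∀ (X : VSet n) w → wt X w X ≡ ∑∈ X (wv w)
  wt-self X w = begin
    wt X w X                           ≡⟨ wt-split X w X ⟩
    ∑∈ X (wv w) + edgeWt X w X         ≡⟨ cong (∑∈ X (wv w) +_) (cong₂ _+_ no-outgoing no-pairs) ⟩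
    ∑∈ X (wv w) + 0                    ≡⟨ +-identityʳ _ ⟩
    ∑∈ X (wv w)                        ∎
    where
    open ≡-Reasoning
    X∖X≢true : ∀ u → (X ∖ X) u ≢ true
    X∖X≢true u with X u
    ... | true  = λ ()
    ... | false = λ ()
    no-outgoing : ∑∈ X (λ u → ∑∈ (X ∖ X) (wo w u)) ≡ 0
    no-outgoing = ∑∈-vanish X (λ u → ∑∈ (X ∖ X) (wo w u))
      (λ u _ → ∑∈-vanish (X ∖ X) (wo w u) (λ v X∖Xv → contradiction X∖Xv (X∖X≢true v)))
    no-pairs : ∑pairs∈ (X ∖ X) (wu w) ≡ 0
    no-pairs = ∑pairs∈-empty (wu w) (λ v → ¬-not (X∖X≢true v))

  wt-∪-antitone : ∀ {Y Z S S' : VSet n} {w} → WeightLaws w → Disjoint Y Z → S' ⊆ S → S ∖ S' ⊆ Z → S ⊆ Y ∪ Z →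
    wt (Y ∪ Z) w S + wt Z w (S' ∩ Z) ≤ wt (Y ∪ Z) w S' + wt Z w (S ∩ Z)
  wt-∪-antitone {Y} {Z} {S} {S'} {w} laws Y∩Z≡∅ S'⊆S S∖S'⊆Z S⊆Y∪Z = begin
    wt (Y ∪ Z) w S + wt Z w (S' ∩ Z)
      ≡⟨ cong (_+ wt Z w (S' ∩ Z)) (wt-∪ laws Y∩Z≡∅ S⊆Y∪Z) ⟩
    (wt Y w (S ∩ Y) + wt Z w (S ∩ Z) + cross Y Z w S) + wt Z w (S' ∩ Z)
      ≡⟨ swap-middle (wt Y w (S ∩ Y)) (wt Z w (S ∩ Z)) (cross Y Z w S) (wt Z w (S' ∩ Z)) ⟩
    (wt Y w (S ∩ Y) + wt Z w (S' ∩ Z) + cross Y Z w S) + wt Z w (S ∩ Z)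
      ≤⟨ +-monoˡ-≤ (wt Z w (S ∩ Z))
           (+-mono-≤ (≤-reflexive (cong (_+ wt Z w (S' ∩ Z)) (wt-congˢ Y w (∩Y-agree Y∩Z≡∅ S'⊆S S∖S'⊆Z))))
                     (cross-antitone Y∩Z≡∅ S'⊆S S∖S'⊆Z laws)) ⟩
    (wt Y w (S' ∩ Y) + wt Z w (S' ∩ Z) + cross Y Z w S') + wt Z w (S ∩ Z)
      ≡⟨ cong (_+ wt Z w (S ∩ Z)) (wt-∪ laws Y∩Z≡∅ (λ u S'u → S⊆Y∪Z u (S'⊆S u S'u))) ⟨
    wt (Y ∪ Z) w S' + wt Z w (S ∩ Z) ∎
    where
    open ≤-Reasoning
    swap-middle : ∀ a b c d → (a + b + c) + d ≡ (a + d + c) + b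
    swap-middle = solve-∀

  wt-remove : ∀ {X S S' : VSet n} {w} → WeightLaws w → S' ⊆ S → S ⊆ X →
    wt X w S ≤ wt X w S' + ∑∈ (S ∖ S') (wv w)
  wt-remove {X} {S} {S'} {w} laws S'⊆S S⊆X = begin
    wt X w S
      ≤⟨ m≤m+n (wt X w S) (wt Z w (S' ∩ Z)) ⟩
    wt X w S + wt Z w (S' ∩ Z)
      ≡⟨ cong (_+ wt Z w (S' ∩ Z)) (wt-congˣ w S X≐Y∪Z) ⟩
    wt (Y ∪ Z) w S + wt Z w (S' ∩ Z)
      ≤⟨ wt-∪-antitone laws Y∩Z≡∅ S'⊆S (λ _ Zu → Zu) S⊆Y∪Z ⟩
    wt (Y ∪ Z) w S' + wt Z w (S ∩ Z)
      ≡⟨ cong₂ _+_ (wt-congˣ w S' (λ u → sym (X≐Y∪Z u))) (trans (wt-congˢ Z w S∩Z≐Z) (wt-self Z w)) ⟩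
    wt X w S' + ∑∈ Z (wv w) ∎
    where
    open ≤-Reasoning
    Z = S ∖ S'
    Y = X ∖ Z
    Y∩Z≡∅ : Disjoint Y Z
    Y∩Z≡∅ u Yu with X u | Z u
    ... | true | false = refl
    X≐Y∪Z : X ≐ Y ∪ Z
    X≐Y∪Z u with X u in Xu | S u in Su | S' u
    ... | true  | true  | true  = refl
    ... | true  | true  | false = refl
    ... | true  | false | _     = refl
    ... | false | true  | _     = contradiction (trans (sym (S⊆X u Su)) Xu) λ ()
    ... | false | false | _     = refl
    S⊆Y∪Z : S ⊆ Y ∪ Z
    S⊆Y∪Z u Su = trans (sym (X≐Y∪Z u)) (S⊆X u Su)
    S∩Z≐Z : S ∩ Z ≐ Z
    S∩Z≐Z u with S u
    ... | true  = refl
    ... | false = refl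

  wt-remove-one : ∀ {X S : VSet n} {w} → WeightLaws w → S ⊆ X → ∀ c → wt X w S ≤ wt X w (S ∖ ｛ c ｝) + wv w c
  wt-remove-one {X} {S} {w} laws S⊆X c = begin
    wt X w S
      ≤⟨ wt-remove laws (∖-⊆ S ｛ c ｝) S⊆X ⟩
    wt X w (S ∖ ｛ c ｝) + ∑∈ (S ∖ (S ∖ ｛ c ｝)) (wv w)
      ≤⟨ +-monoʳ-≤ (wt X w (S ∖ ｛ c ｝)) (∑∈-mono-⊆ (wv w) only-c) ⟩
    wt X w (S ∖ ｛ c ｝) + ∑∈ ｛ c ｝ (wv w)
      ≡⟨ cong (wt X w (S ∖ ｛ c ｝) +_) (∑∈-｛｝ (wv w) (λ _ → refl)) ⟩
    wt X w (S ∖ ｛ c ｝) + wv w c ∎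
    where
    open ≤-Reasoning
    only-c : S ∖ (S ∖ ｛ c ｝) ⊆ ｛ c ｝
    only-c u removed with S u | u == c
    ... | true | true = refl

  vertices≤wt : ∀ X w (S : VSet n) → ∑∈ S (wv w) ≤ wt X w S
  vertices≤wt X w S = ≤-trans (m≤m+n _ _) (≤-reflexive (sym (wt-split X w S)))

  wv≤wt-｛｝ : ∀ X w (c : Fin n) → wv w c ≤ wt X w ｛ c ｝
  wv≤wt-｛｝ X w c = ≤-trans (≤-reflexive (sym (∑∈-｛｝ (wv w) (λ _ → refl)))) (vertices≤wt X w ｛ c ｝)

not-strong : ∀ {a} → a ≢ strong → isStrong a ≡ false
not-strong {strong} a≢strong = contradiction refl a≢strong
not-strong {semi}   _ = refl
not-strong {anti}   _ = refl

module _ {n : ℕ} where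

  Independent : Adjacency n → VSet n → Set
  Independent θ S = ∀ u v → S u ≡ true → S v ≡ true → u ≢ v → isStrong (θ u v) ≡ false

  Stable : VSet n → Adjacency n → VSet n → Set
  Stable X θ S = S ⊆ X × Independent θ S

  independent-⊆ : ∀ {θ S S'} → S' ⊆ S → Independent θ S → Independent θ S'
  independent-⊆ S'⊆S indep u v S'u S'v = indep u v (S'⊆S u S'u) (S'⊆S v S'v)

  stable-⊆ : ∀ {X θ S S'} → S' ⊆ S → Stable X θ S → Stable X θ S'
  stable-⊆ S'⊆S (S⊆X , indep) = ⊆-trans S'⊆S S⊆X , independent-⊆ S'⊆S indep

  independent-∪ : ∀ {θ P Q} → Symmetric θ → Independent θ P → Independent θ Q →
    (∀ u v → P u ≡ true → Q v ≡ true → u ≢ v → isStrong (θ u v) ≡ false) → Independent θ (P ∪ Q)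
  independent-∪ {θ} {P} θ-sym P-indep Q-indep across u v P∪Qu P∪Qv u≢v with P u in Pu | P v in Pv
  ... | true  | true  = P-indep u v Pu Pv u≢v
  ... | true  | false = across u v Pu P∪Qv u≢v
  ... | false | true  = trans (cong isStrong (θ-sym u v)) (across v u Pv P∪Qu (u≢v ∘ sym))
  ... | false | false = Q-indep u v P∪Qu P∪Qv u≢v

  ｛｝-stable : ∀ {X θ} {c : Fin n} → X c ≡ true → Stable X θ ｛ c ｝
  ｛｝-stable {X} Xc = (λ u u==c → subst (λ x → X x ≡ true) (sym (==⇒≡ u==c)) Xc)
                    , (λ u v u==c v==c u≢v → contradiction (trans (==⇒≡ u==c) (sym (==⇒≡ v==c))) u≢v)

  private
    allF⇒ : ∀ {m} (p : Fin m → Bool) → allF p ≡ true → ∀ u → p u ≡ true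
    allF⇒ p all-p zero    with p zero
    ... | true = refl
    allF⇒ p all-p (suc u) with p zero
    ... | true = allF⇒ (p ∘ suc) all-p u

    ⇒allF : ∀ {m} (p : Fin m → Bool) → (∀ u → p u ≡ true) → allF p ≡ true
    ⇒allF {zero}  p all-p = refl
    ⇒allF {suc m} p all-p rewrite all-p zero = ⇒allF (p ∘ suc) (all-p ∘ suc)

    not∨⇒ : ∀ {a b} → not a ∨ b ≡ true → a ≡ true → b ≡ true
    not∨⇒ {true} b≡true refl = b≡true

    ⇒not∨ : ∀ {a b} → (a ≡ true → b ≡ true) → not a ∨ b ≡ true
    ⇒not∨ {true}  a⇒b = a⇒b refl
    ⇒not∨ {false} a⇒b = refl

  isStable-sound : ∀ {X θ S} → isStable X θ S ≡ true → Stable X θ S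
  isStable-sound {X} {θ} {S} stable with allF (λ u → not (S u) ∨ X u) in inside
  ... | true = (λ u → not∨⇒ (allF⇒ _ inside u))
             , (λ u v Su Sv u≢v → pair-not-strong (not∨⇒ (not∨⇒ (allF⇒ _ (allF⇒ _ stable u) v) Su) Sv) u≢v)
    where
    pair-not-strong : ∀ {u v} → (u == v) ∨ not (isStrong (θ u v)) ≡ true → u ≢ v → isStrong (θ u v) ≡ false
    pair-not-strong {u} {v} p u≢v rewrite ==-≢ u≢v with isStrong (θ u v)
    ... | false = refl

  isStable-complete : ∀ {X θ S} → Stable X θ S → isStable X θ S ≡ true
  isStable-complete {X} {θ} {S} (S⊆X , indep) =
    cong₂ _∧_ (⇒allF _ (λ u → ⇒not∨ (S⊆X u)))
              (⇒allF _ (λ u → ⇒allF _ (λ v → ⇒not∨ (λ Su → ⇒not∨ (λ Sv → pair u v Su Sv)))))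
    where
    pair : ∀ u v → S u ≡ true → S v ≡ true → (u == v) ∨ not (isStrong (θ u v)) ≡ true
    pair u v Su Sv with u ≟ v
    ... | yes _   = refl
    ... | no  u≢v rewrite indep u v Su Sv u≢v = refl

  isStable-congˣ : ∀ {X X' : VSet n} (θ : Adjacency n) (S : VSet n) → X ≐ X' → isStable X θ S ≡ isStable X' θ S
  isStable-congˣ θ S X≐X' =
    cong (_∧ allF (λ u → allF (λ v → not (S u) ∨ not (S v) ∨ (u == v) ∨ not (isStrong (θ u v)))))
         (allF-cong (λ u → cong (not (S u) ∨_) (X≐X' u)))
    where
    allF-cong : ∀ {m} {p q : Fin m → Bool} → (∀ u → p u ≡ q u) → allF p ≡ allF q
    allF-cong {zero}  p≗q = refl
    allF-cong {suc m} p≗q = cong₂ _∧_ (p≗q zero) (allF-cong (p≗q ∘ suc))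

subsets-complete : ∀ n (S : VSet n) → Any (_≐ S) (subsets n)
subsets-complete zero    S = here (λ ())
subsets-complete (suc n) S =
  concatMap⁺ (λ S' → (false VF.∷ S') ∷ (true VF.∷ S') ∷ []) (Any.map extend (subsets-complete n (S ∘ suc)))
  where
  extend : ∀ {S'} → S' ≐ S ∘ suc → Any (_≐ S) ((false VF.∷ S') ∷ (true VF.∷ S') ∷ [])
  extend S'≐ with S zero in S₀
  ... | false = here λ { zero → sym S₀ ; (suc u) → S'≐ u }
  ... | true  = there (here λ { zero → sym S₀ ; (suc u) → S'≐ u })

module _ {n : ℕ} where

  αOver : VSet n → Adjacency n → Weight n → List (VSet n) → ℕ
  αOver X θ w = foldr (λ S acc → if isStable X θ S then wt X w S ⊔ acc else acc) 0

  α-upper : ∀ {X θ S} w → Stable X θ S → wt X w S ≤ α X θ w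
  α-upper {X} {θ} {S} w stable = go (subsets n) (subsets-complete n S)
    where
    go : ∀ L → Any (_≐ S) L → wt X w S ≤ αOver X θ w L
    go (S' ∷ L) (here S'≐S) rewrite isStable-complete (stable-⊆ (λ u → subst (_≡ true) (S'≐S u)) stable)
      = ≤-trans (≤-reflexive (wt-congˢ X w (sym ∘ S'≐S))) (m≤m⊔n _ _)
    go (S' ∷ L) (there S∈L) with isStable X θ S'
    ... | true  = ≤-trans (go L S∈L) (m≤n⊔m _ _)
    ... | false = go L S∈L

  α-attained : ∀ X θ w → Σ[ S ∈ VSet n ] Stable X θ S × α X θ w ≤ wt X w S
  α-attained X θ w = go (subsets n)
    where
    go : ∀ L → Σ[ S ∈ VSet n ] Stable X θ S × αOver X θ w L ≤ wt X w S
    go []      = ∅ , ((λ _ ()) , (λ _ _ ())) , z≤n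
    go (S ∷ L) with isStable X θ S in stable | go L
    ... | false | best = best
    ... | true  | (S* , stable* , αL≤) with ⊔-sel (wt X w S) (αOver X θ w L)
    ...   | inj₁ ⊔≡S = S  , isStable-sound stable , ≤-reflexive ⊔≡S
    ...   | inj₂ ⊔≡L = S* , stable* , ≤-trans (≤-reflexive ⊔≡L) αL≤

  α-cong : ∀ {X X'} θ {w w'} → X ≐ X' → (∀ S → wt X w S ≡ wt X' w' S) → α X θ w ≡ α X' θ w'
  α-cong {X} {X'} θ {w} {w'} X≐X' wt≗ = go (subsets n)
    where
    go : ∀ L → αOver X θ w L ≡ αOver X' θ w' L
    go []      = refl
    go (S ∷ L) = trans (cong (λ b → if b then wt X w S ⊔ αOver X θ w L else αOver X θ w L)
                             (isStable-congˣ {X = X} θ S X≐X'))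
                       (step (isStable X' θ S))
      where
      step : ∀ b → (if b then wt X w S ⊔ αOver X θ w L else αOver X θ w L)
                 ≡ (if b then wt X' w' S ⊔ αOver X' θ w' L else αOver X' θ w' L)
      step true  = cong₂ _⊔_ (wt≗ S) (go L)
      step false = go L

-- Red and Ext

module _ {n : ℕ} where

  -- the amount by which Red[G,w;R] lowers w(u), before truncation at 0
  redLoss : VSet n → Weight n → VSet n → Fin n → ℕ
  redLoss X w R u = ∑∈ (X ∖ R) (λ v → wu w u v ∸ wo w u v)

  wt-∅ : ∀ (X : VSet n) w {S} → (∀ u → S u ≡ false) → wt X w S ≡ ∑pairs∈ X (wu w)
  wt-∅ X w {S} S≡∅ = begin
    wt X w S
      ≡⟨ wt-split X w S ⟩
    ∑∈ S (wv w) + (∑∈ S (λ u → ∑∈ (X ∖ S) (wo w u)) + ∑pairs∈ (X ∖ S) (wu w))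
      ≡⟨ cong₂ (λ a b → a + (b + ∑pairs∈ (X ∖ S) (wu w))) (∑∈-vanish S (wv w) absurd) (∑∈-vanish S _ absurd) ⟩
    ∑pairs∈ (X ∖ S) (wu w)
      ≡⟨ ∑pairs∈-cong (wu w) (λ u → trans (cong (λ s → X u ∧ not s) (S≡∅ u)) (∧-identityʳ (X u))) ⟩
    ∑pairs∈ X (wu w) ∎
    where
    open ≡-Reasoning
    absurd : ∀ {f : Fin n → ℕ} u → S u ≡ true → f u ≡ 0
    absurd u Su = contradiction (trans (sym Su) (S≡∅ u)) λ ()

  wt-Ext : ∀ {X R S : VSet n} {w} → WeightLaws w → R ⊆ X → S ⊆ R →
    wt X w S + ∑∈ S (redLoss X w R) ≡ wt R w S + Ext X w R
  wt-Ext {X} {R} {S} {w} laws R⊆X S⊆R = begin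
    wt X w S + lost
      ≡⟨ cong (_+ lost) (trans (wt-congˣ w S X≐R∪Z) (wt-∪ laws R∩Z≡∅ S⊆R∪Z)) ⟩
    (wt R w (S ∩ R) + wt Z w (S ∩ Z) + cross R Z w S) + lost
      ≡⟨ cong (_+ lost) (cong₃ (λ a b c → a + b + c) (wt-congˢ R w S∩R≐S) (wt-∅ Z w S∩Z-empty) cross≡) ⟩
    (wt R w S + ∑pairs∈ Z (wu w) + (out wo S + 0 + out wu (R ∖ S))) + lost
      ≡⟨ regroup (wt R w S) (∑pairs∈ Z (wu w)) (out wo S) (out wu (R ∖ S)) lost ⟩
    wt R w S + (∑pairs∈ Z (wu w) + ((lost + out wo S) + out wu (R ∖ S)))
      ≡⟨ cong (λ x → wt R w S + (∑pairs∈ Z (wu w) + (x + out wu (R ∖ S)))) loss+kept ⟩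
    wt R w S + (∑pairs∈ Z (wu w) + (out wu S + out wu (R ∖ S)))
      ≡⟨ cong (λ x → wt R w S + (∑pairs∈ Z (wu w) + x)) (trans (sym (∑∈-∪ _ S∩R∖S≡∅)) (∑∈-congˡ _ R≐S∪R∖S)) ⟩
    wt R w S + Ext X w R ∎
    where
    open ≡-Reasoning
    Z = X ∖ R
    lost = ∑∈ S (redLoss X w R)
    out : (Weight n → Fin n → Fin n → ℕ) → VSet n → ℕ
    out f P = ∑∈ P (λ u → ∑∈ Z (f w u))
    cong₃ : ∀ {a b c a' b' c' : ℕ} (f : ℕ → ℕ → ℕ → ℕ) → a ≡ a' → b ≡ b' → c ≡ c' → f a b c ≡ f a' b' c'
    cong₃ f refl refl refl = refl
    regroup : ∀ a p o q l → (a + p + (o + 0 + q)) + l ≡ a + (p + ((l + o) + q))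
    regroup = solve-∀
    S∩Z≡∅ : Disjoint S Z
    S∩Z≡∅ u Su rewrite S⊆R u Su = ∧-zeroʳ (X u)
    R∩Z≡∅ : Disjoint R Z
    R∩Z≡∅ u Ru rewrite Ru = ∧-zeroʳ (X u)
    X≐R∪Z : X ≐ R ∪ Z
    X≐R∪Z u with R u in Ru
    ... | true  = R⊆X u Ru
    ... | false = sym (∧-identityʳ (X u))
    S⊆R∪Z : S ⊆ R ∪ Z
    S⊆R∪Z u Su = trans (sym (X≐R∪Z u)) (R⊆X u (S⊆R u Su))
    S∩R≐S : S ∩ R ≐ S
    S∩R≐S u with S u in Su
    ... | true  = S⊆R u Su
    ... | false = refl
    S∩Z-empty : ∀ u → (S ∩ Z) u ≡ false
    S∩Z-empty u with S u in Su
    ... | true  = S∩Z≡∅ u Su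
    ... | false = refl
    Z∖S≐Z : Z ∖ S ≐ Z
    Z∖S≐Z u with S u in Su
    ... | true  = trans (∧-zeroʳ (Z u)) (sym (S∩Z≡∅ u Su))
    ... | false = ∧-identityʳ (Z u)
    S∩R∖S≡∅ : Disjoint S (R ∖ S)
    S∩R∖S≡∅ u Su rewrite Su = ∧-zeroʳ (R u)
    R≐S∪R∖S : S ∪ (R ∖ S) ≐ R
    R≐S∪R∖S u with S u in Su
    ... | true  = sym (S⊆R u Su)
    ... | false = ∧-identityʳ (R u)
    cross≡ : cross R Z w S ≡ out wo S + 0 + out wu (R ∖ S)
    cross≡ = cong₃ (λ a b c → a + b + c)
      (∑∈-cong S∩R≐S (λ u _ → ∑∈-congˡ (wo w u) Z∖S≐Z))
      (∑∈-vanish (S ∩ Z) _ (λ u SZu → contradiction (trans (sym SZu) (S∩Z-empty u)) λ ()))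
      (∑∈-congʳ (R ∖ S) (λ u _ → ∑∈-congˡ (wu w u) Z∖S≐Z))
    loss+kept : lost + out wo S ≡ out wu S
    loss+kept = trans (sym (∑∈-+ S (redLoss X w R) (λ u → ∑∈ Z (wo w u))))
      (∑∈-congʳ S (λ u Su → trans (sym (∑∈-+ Z _ (wo w u)))
        (∑∈-congʳ Z (λ v Zv → m∸n+n≡m (wo≤wu laws u v (disjoint⇒≢ S∩Z≡∅ Su Zv))))))

  private
    wt-redW+loss : ∀ (X R S : VSet n) w → wt R (redW X w R) S + ∑∈ S (redLoss X w R)
                 ≡ ∑∈ S (λ u → redLoss X w R u + (wv w u ∸ redLoss X w R u)) + edgeWt R w S
    wt-redW+loss X R S w = begin
      wt R (redW X w R) S + ∑∈ S (redLoss X w R)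
        ≡⟨ cong (_+ ∑∈ S (redLoss X w R)) (wt-split R (redW X w R) S) ⟩
      (∑∈ S (wv (redW X w R)) + edgeWt R w S) + ∑∈ S (redLoss X w R)
        ≡⟨ rotate (∑∈ S (wv (redW X w R))) (edgeWt R w S) (∑∈ S (redLoss X w R)) ⟩
      (∑∈ S (redLoss X w R) + ∑∈ S (wv (redW X w R))) + edgeWt R w S
        ≡⟨ cong (_+ edgeWt R w S) (∑∈-+ S (redLoss X w R) (wv (redW X w R))) ⟨
      ∑∈ S (λ u → redLoss X w R u + (wv w u ∸ redLoss X w R u)) + edgeWt R w S ∎
      where
      open ≡-Reasoning
      rotate : ∀ a b c → (a + b) + c ≡ (c + a) + b
      rotate = solve-∀

  αRedExt-upper : ∀ {X R S : VSet n} {θ w} → WeightLaws w → R ⊆ X → Stable X θ S → S ⊆ R →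
    wt X w S ≤ αRedExt X θ w R
  αRedExt-upper {X} {R} {S} {θ} {w} laws R⊆X (_ , indep) S⊆R = +-cancelʳ-≤ lost _ _ (begin
    wt X w S + lost
      ≡⟨ wt-Ext laws R⊆X S⊆R ⟩
    wt R w S + Ext X w R
      ≡⟨ cong (_+ Ext X w R) (wt-split R w S) ⟩
    (∑∈ S (wv w) + edgeWt R w S) + Ext X w R
      ≤⟨ +-monoˡ-≤ (Ext X w R) (+-monoˡ-≤ (edgeWt R w S)
           (∑∈-mono S (λ u _ → m≤n+m∸n (wv w u) (redLoss X w R u)))) ⟩
    (∑∈ S (λ u → redLoss X w R u + (wv w u ∸ redLoss X w R u)) + edgeWt R w S) + Ext X w R
      ≡⟨ cong (_+ Ext X w R) (wt-redW+loss X R S w) ⟨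
    (wt R w' S + lost) + Ext X w R
      ≤⟨ +-monoˡ-≤ (Ext X w R) (+-monoˡ-≤ lost (α-upper w' (S⊆R , indep))) ⟩
    (α R θ w' + lost) + Ext X w R
      ≡⟨ +-comm-right (α R θ w') lost (Ext X w R) ⟩
    αRedExt X θ w R + lost ∎)
    where
    open ≤-Reasoning
    w' = redW X w R
    lost = ∑∈ S (redLoss X w R)
    +-comm-right : ∀ a b c → (a + b) + c ≡ (a + c) + b
    +-comm-right = solve-∀

  αRedExt-attained : ∀ {X R : VSet n} θ {w} → WeightLaws w → R ⊆ X →
    Σ[ S ∈ VSet n ] Stable X θ S × S ⊆ R × αRedExt X θ w R ≤ wt X w S
  αRedExt-attained {X} {R} θ {w} laws R⊆X with α-attained R θ (redW X w R)
  ... | S , (S⊆R , indep) , α≤ = S' , stable-⊆ S'⊆S (⊆-trans S⊆R R⊆X , indep) , ⊆-trans S'⊆S S⊆R , (begin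
    α R θ w' + Ext X w R
      ≤⟨ +-monoˡ-≤ (Ext X w R) (≤-trans α≤ drop-unfit) ⟩
    wt R w' S' + Ext X w R
      ≡⟨ +-cancelʳ-≡ lost _ _ (begin-equality
           (wt R w' S' + Ext X w R) + lost
             ≡⟨ +-comm-right (wt R w' S') (Ext X w R) lost ⟩
           (wt R w' S' + lost) + Ext X w R
             ≡⟨ cong (_+ Ext X w R) (trans (wt-redW+loss X R S' w) fits-exactly) ⟩
           wt R w S' + Ext X w R
             ≡⟨ wt-Ext laws R⊆X (⊆-trans S'⊆S S⊆R) ⟨
           wt X w S' + lost ∎) ⟩
    wt X w S' ∎)
    where
    open ≤-Reasoning
    w' = redW X w R
    fits : VSet n
    fits u = redLoss X w R u ≤ᵇ wv w u
    S' = S ∩ fits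
    lost = ∑∈ S' (redLoss X w R)
    S'⊆S : S' ⊆ S
    S'⊆S u S'u with S u
    ... | true = refl
    laws' : WeightLaws w'
    laws' = record { wo≤wu = wo≤wu laws ; wu-sym = wu-sym laws }
    drop-unfit : wt R w' S ≤ wt R w' S'
    drop-unfit = begin
      wt R w' S                        ≤⟨ wt-remove laws' S'⊆S S⊆R ⟩
      wt R w' S' + ∑∈ (S ∖ S') (wv w') ≡⟨ cong (wt R w' S' +_) (∑∈-vanish (S ∖ S') (wv w') unfit-zero) ⟩
      wt R w' S' + 0                   ≡⟨ +-identityʳ _ ⟩
      wt R w' S'                       ∎
      where
      unfit-zero : ∀ u → (S ∖ S') u ≡ true → wv w' u ≡ 0
      unfit-zero u S∖S'u with S u | redLoss X w R u ≤ᵇ wv w u in fit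
      ... | true | false = m≤n⇒m∸n≡0 (<⇒≤ (≤ᵇ-false⇒> {redLoss X w R u} {wv w u} fit))
    fits-exactly : ∑∈ S' (λ u → redLoss X w R u + (wv w u ∸ redLoss X w R u)) + edgeWt R w S' ≡ wt R w S'
    fits-exactly = sym (trans (wt-split R w S') (cong (_+ edgeWt R w S') (∑∈-congʳ S' exact)))
      where
      exact : ∀ u → S' u ≡ true → wv w u ≡ redLoss X w R u + (wv w u ∸ redLoss X w R u)
      exact u S'u with S u | redLoss X w R u ≤ᵇ wv w u in fit
      ... | true | true = sym (m+[n∸m]≡n (≤ᵇ-true⇒≤ {redLoss X w R u} {wv w u} fit))
    +-comm-right : ∀ a b c → (a + b) + c ≡ (a + c) + b
    +-comm-right = solve-∀

  αRedExt-cong : ∀ X θ w {R R' : VSet n} → R ≐ R' → αRedExt X θ w R ≡ αRedExt X θ w R'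
  αRedExt-cong X θ w {R} {R'} R≐R' = cong₂ _+_ (α-cong θ R≐R' wt-red≗)
    (cong₂ _+_ (∑pairs∈-cong (wu w) X∖R≐X∖R') (∑∈-cong R≐R' (λ u _ → ∑∈-congˡ (wu w u) X∖R≐X∖R')))
    where
    X∖R≐X∖R' : X ∖ R ≐ X ∖ R'
    X∖R≐X∖R' u = cong (λ r → X u ∧ not r) (R≐R' u)
    wt-red≗ : ∀ S → wt R (redW X w R) S ≡ wt R' (redW X w R') S
    wt-red≗ S = begin
      wt R (redW X w R) S
        ≡⟨ wt-split R (redW X w R) S ⟩
      ∑∈ S (wv (redW X w R)) + edgeWt R w S
        ≡⟨ cong₂ _+_ (∑∈-congʳ S (λ u _ → cong (wv w u ∸_) (∑∈-congˡ _ X∖R≐X∖R')))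
                     (edgeWt-cong w R≐R' (λ _ → refl)) ⟩
      ∑∈ S (wv (redW X w R')) + edgeWt R' w S
        ≡⟨ wt-split R' (redW X w R') S ⟨
      wt R' (redW X w R') S ∎
      where open ≡-Reasoning

-- Gluing along a common part

module _ {n : ℕ} where

  AgreeOutside : VSet n → Weight n → Weight n → Set
  AgreeOutside Z w w' = ∀ u → Z u ≡ false →
    wv w u ≡ wv w' u × (∀ v → wo w u v ≡ wo w' u v × wo w v u ≡ wo w' v u × wu w u v ≡ wu w' u v)

  NoWeightBetween : VSet n → VSet n → Weight n → Set
  NoWeightBetween Y Z w = ∀ u v → Y u ≡ true → Z v ≡ true → wo w u v ≡ 0 × wo w v u ≡ 0 × wu w u v ≡ 0

  agree-∩ : ∀ {P S S' : VSet n} → (∀ u → P u ≡ true → S u ≡ S' u) → S ∩ P ≐ S' ∩ P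
  agree-∩ {P} {S} {S'} agree u with P u in Pu
  ... | true  = cong (_∧ true) (agree u Pu)
  ... | false = trans (∧-zeroʳ (S u)) (sym (∧-zeroʳ (S' u)))

  agree-∖ : ∀ {P S S' : VSet n} → (∀ u → P u ≡ true → S u ≡ S' u) → P ∖ S ≐ P ∖ S'
  agree-∖ {P} agree u with P u in Pu
  ... | true  = cong not (agree u Pu)
  ... | false = refl

  cross-congˢ : ∀ {Y Z S S' : VSet n} w → (∀ u → (Y ∪ Z) u ≡ true → S u ≡ S' u) → cross Y Z w S ≡ cross Y Z w S'
  cross-congˢ {Y} {Z} w agree = cong₂ _+_
    (cong₂ _+_ (∑∈-cong (agree-∩ onY) (λ u _ → ∑∈-congˡ (wo w u) (agree-∖ onZ)))
               (∑∈-cong (agree-∩ onZ) (λ u _ → ∑∈-congˡ (wo w u) (agree-∖ onY))))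
    (∑∈-cong (agree-∖ onY) (λ u _ → ∑∈-congˡ (wu w u) (agree-∖ onZ)))
    where
    onY : ∀ u → Y u ≡ true → _
    onY u Yu = agree u (cong (_∨ Z u) Yu)
    onZ : ∀ u → Z u ≡ true → _
    onZ u Zu = agree u (trans (cong (Y u ∨_) Zu) (∨-zeroʳ (Y u)))

  module _ {Z : VSet n} {w w'} (agree : AgreeOutside Z w w') where

    private
      wv-agree : ∀ {u} → Z u ≡ false → wv w u ≡ wv w' u
      wv-agree {u} Zu = proj₁ (agree u Zu)
      wo-agree : ∀ {u} v → Z u ≡ false → wo w u v ≡ wo w' u v
      wo-agree {u} v Zu = proj₁ (proj₂ (agree u Zu) v)
      wo-agree′ : ∀ u {v} → Z v ≡ false → wo w u v ≡ wo w' u v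
      wo-agree′ u {v} Zv = proj₁ (proj₂ (proj₂ (agree v Zv) u))
      wu-agree : ∀ {u} v → Z u ≡ false → wu w u v ≡ wu w' u v
      wu-agree {u} v Zu = proj₂ (proj₂ (proj₂ (agree u Zu) v))

    wt-congʷ : ∀ {X S : VSet n} → Disjoint X Z → S ⊆ X → wt X w S ≡ wt X w' S
    wt-congʷ {X} {S} X∩Z≡∅ S⊆X = cong₂ _+_
      (cong₂ _+_ (∑∈-congʳ S (λ u Su → wv-agree (outside (S⊆X u Su))))
                 (∑∈-congʳ S (λ u Su → ∑∈-congʳ (X ∖ S) (λ v _ → wo-agree v (outside (S⊆X u Su))))))
      (∑pairs∈-congʳ (X ∖ S) (λ u v X∖Su _ → wu-agree v (outside (∖-⊆ X S u X∖Su))))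
      where
      outside : ∀ {u} → X u ≡ true → Z u ≡ false
      outside {u} = X∩Z≡∅ u

    cross-congʷ : ∀ {Y S : VSet n} → Disjoint Y Z → cross Y Z w S ≡ cross Y Z w' S
    cross-congʷ {Y} {S} Y∩Z≡∅ = cong₂ _+_
      (cong₂ _+_ (∑∈-congʳ (S ∩ Y) (λ u SYu → ∑∈-congʳ (Z ∖ S) (λ v _ → wo-agree v (outside (∩-⊆ʳ S Y u SYu)))))
                 (∑∈-congʳ (S ∩ Z) (λ u _ → ∑∈-congʳ (Y ∖ S) (λ v Y∖Sv →
                   wo-agree′ u (outside (∖-⊆ Y S v Y∖Sv))))))
      (∑∈-congʳ (Y ∖ S) (λ u Y∖Su → ∑∈-congʳ (Z ∖ S) (λ v _ → wu-agree v (outside (∖-⊆ Y S u Y∖Su)))))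
      where
      outside : ∀ {u} → Y u ≡ true → Z u ≡ false
      outside {u} = Y∩Z≡∅ u

  wt-∪-reweight : ∀ {Y Z S : VSet n} {w w'} → WeightLaws w → WeightLaws w' → AgreeOutside Z w w' →
    Disjoint Y Z → S ⊆ Y ∪ Z →
    wt (Y ∪ Z) w' S + wt Z w (S ∩ Z) ≡ wt (Y ∪ Z) w S + wt Z w' (S ∩ Z)
  wt-∪-reweight {Y} {Z} {S} {w} {w'} laws laws' agree Y∩Z≡∅ S⊆Y∪Z = begin
    wt (Y ∪ Z) w' S + wt Z w (S ∩ Z)
      ≡⟨ cong (_+ wt Z w (S ∩ Z)) (wt-∪ laws' Y∩Z≡∅ S⊆Y∪Z) ⟩
    (wt Y w' (S ∩ Y) + wt Z w' (S ∩ Z) + cross Y Z w' S) + wt Z w (S ∩ Z)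
      ≡⟨ cong₂ (λ a c → (a + wt Z w' (S ∩ Z) + c) + wt Z w (S ∩ Z))
               (sym (wt-congʷ agree Y∩Z≡∅ (∩-⊆ʳ S Y))) (sym (cross-congʷ agree Y∩Z≡∅)) ⟩
    (wt Y w (S ∩ Y) + wt Z w' (S ∩ Z) + cross Y Z w S) + wt Z w (S ∩ Z)
      ≡⟨ exchange (wt Y w (S ∩ Y)) (wt Z w' (S ∩ Z)) (cross Y Z w S) (wt Z w (S ∩ Z)) ⟩
    (wt Y w (S ∩ Y) + wt Z w (S ∩ Z) + cross Y Z w S) + wt Z w' (S ∩ Z)
      ≡⟨ cong (_+ wt Z w' (S ∩ Z)) (wt-∪ laws Y∩Z≡∅ S⊆Y∪Z) ⟨
    wt (Y ∪ Z) w S + wt Z w' (S ∩ Z) ∎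
    where
    open ≡-Reasoning
    exchange : ∀ a b c d → (a + b + c) + d ≡ (a + d + c) + b
    exchange = solve-∀

  cross-∪-null : ∀ {Y M' M S : VSet n} {w} → Disjoint M' M → NoWeightBetween Y M' w →
    cross Y (M' ∪ M) w S ≡ cross Y M w S
  cross-∪-null {Y} {M'} {M} {S} {w} M'∩M≡∅ null = cong₂ _+_
    (cong₂ _+_
      (∑∈-congʳ (S ∩ Y) (λ u SYu → drop-M' (wo w u) (λ v M'v → wo-Y-M' (∩-⊆ʳ S Y u SYu) M'v)))
      (trans (∑∈-congˡ (λ u → ∑∈ (Y ∖ S) (wo w u)) (λ u → ∧-distribˡ-∨ (S u) (M' u) (M u)))
        (∑∈-∪-vanishˡ (λ u → ∑∈ (Y ∖ S) (wo w u)) (∩-disjoint {S = S} M'∩M≡∅)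
          (λ u SM'u → ∑∈-vanish (Y ∖ S) (wo w u) (λ v Y∖Sv → wo-M'-Y (∩-⊆ʳ S M' u SM'u) (∖-⊆ Y S v Y∖Sv))))))
    (∑∈-congʳ (Y ∖ S) (λ u Y∖Su → drop-M' (wu w u) (λ v M'v → wu-Y-M' (∖-⊆ Y S u Y∖Su) M'v)))
    where
    wo-Y-M' : ∀ {u v} → Y u ≡ true → M' v ≡ true → wo w u v ≡ 0
    wo-Y-M' {u} {v} Yu M'v = proj₁ (null u v Yu M'v)
    wo-M'-Y : ∀ {u v} → M' u ≡ true → Y v ≡ true → wo w u v ≡ 0
    wo-M'-Y {u} {v} M'u Yv = proj₁ (proj₂ (null v u Yv M'u))
    wu-Y-M' : ∀ {u v} → Y u ≡ true → M' v ≡ true → wu w u v ≡ 0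
    wu-Y-M' {u} {v} Yu M'v = proj₂ (proj₂ (null u v Yu M'v))
    drop-M' : ∀ f → (∀ v → M' v ≡ true → f v ≡ 0) → ∑∈ ((M' ∪ M) ∖ S) f ≡ ∑∈ (M ∖ S) f
    drop-M' f f≗0 = trans (∑∈-congˡ f (∖-∪ {Y = M'} {M} {S}))
      (∑∈-∪-vanishˡ f (∖-disjoint {S = S} M'∩M≡∅) (λ v M'∖Sv → f≗0 v (∖-⊆ M' S v M'∖Sv)))

  wt-glue : ∀ {Y M Z S : VSet n} {w} → WeightLaws w →
    Disjoint Y M → Disjoint Z Y → Disjoint Z M → NoWeightBetween Z Y w → S ⊆ Z ∪ (Y ∪ M) →
    wt (Z ∪ (Y ∪ M)) w S + wt M w (S ∩ M) ≡ wt (Y ∪ M) w (S ∩ (Y ∪ M)) + wt (Z ∪ M) w (S ∩ (Z ∪ M))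
  wt-glue {Y} {M} {Z} {S} {w} laws Y∩M≡∅ Z∩Y≡∅ Z∩M≡∅ null S⊆Z∪Y∪M = begin
    wt (Z ∪ (Y ∪ M)) w S + wt M w (S ∩ M)
      ≡⟨ cong (_+ wt M w (S ∩ M)) (wt-∪ laws Z∩YM≡∅ S⊆Z∪Y∪M) ⟩
    (wt Z w (S ∩ Z) + wt (Y ∪ M) w (S ∩ (Y ∪ M)) + cross Z (Y ∪ M) w S) + wt M w (S ∩ M)
      ≡⟨ cong (λ c → (wt Z w (S ∩ Z) + wt (Y ∪ M) w (S ∩ (Y ∪ M)) + c) + wt M w (S ∩ M))
              (trans (cross-∪-null {w = w} Y∩M≡∅ null) (cross-congˢ w (λ u Z∪Mu → sym (S∩Z∪M≐S u Z∪Mu)))) ⟩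
    (wt Z w (S ∩ Z) + wt (Y ∪ M) w (S ∩ (Y ∪ M)) + cross Z M w S₀) + wt M w (S ∩ M)
      ≡⟨ pull-out (wt Z w (S ∩ Z)) (wt (Y ∪ M) w (S ∩ (Y ∪ M))) (cross Z M w S₀) (wt M w (S ∩ M)) ⟩
    wt (Y ∪ M) w (S ∩ (Y ∪ M)) + (wt Z w (S ∩ Z) + wt M w (S ∩ M) + cross Z M w S₀)
      ≡⟨ cong (λ x → wt (Y ∪ M) w (S ∩ (Y ∪ M)) + (x + cross Z M w S₀))
              (cong₂ _+_ (wt-congˢ Z w (∩-absorb {Y = Z ∪ M} {S} (λ u Zu → cong (_∨ M u) Zu)))
                         (wt-congˢ M w (∩-absorb {Y = Z ∪ M} {S} M⊆Z∪M))) ⟨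
    wt (Y ∪ M) w (S ∩ (Y ∪ M)) + (wt Z w (S₀ ∩ Z) + wt M w (S₀ ∩ M) + cross Z M w S₀)
      ≡⟨ cong (wt (Y ∪ M) w (S ∩ (Y ∪ M)) +_) (wt-∪ laws Z∩M≡∅ (∩-⊆ʳ S (Z ∪ M))) ⟨
    wt (Y ∪ M) w (S ∩ (Y ∪ M)) + wt (Z ∪ M) w S₀ ∎
    where
    open ≡-Reasoning
    S₀ = S ∩ (Z ∪ M)
    M⊆Z∪M : M ⊆ Z ∪ M
    M⊆Z∪M u Mu = trans (cong (Z u ∨_) Mu) (∨-zeroʳ (Z u))
    S∩Z∪M≐S : ∀ u → (Z ∪ M) u ≡ true → S₀ u ≡ S u
    S∩Z∪M≐S u Z∪Mu = trans (cong (S u ∧_) Z∪Mu) (∧-identityʳ (S u))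
    Z∩YM≡∅ : Disjoint Z (Y ∪ M)
    Z∩YM≡∅ u Zu rewrite Z∩Y≡∅ u Zu = Z∩M≡∅ u Zu
    pull-out : ∀ a b c d → (a + b + c) + d ≡ b + (a + d + c)
    pull-out = solve-∀

module TwoPoints {n : ℕ} {c₁ c₂ : Fin n} (c₁≢c₂ : c₁ ≢ c₂) {X : VSet n} (X≐c₁c₂ : X ≐ ｛ c₁ ｝ ∪ ｛ c₂ ｝) where

  private
    c₁∩c₂≡∅ : Disjoint ｛ c₁ ｝ ｛ c₂ ｝
    c₁∩c₂≡∅ u u==c₁ rewrite ==⇒≡ u==c₁ = ==-≢ c₁≢c₂

    ∑pairs∈-｛｝ : ∀ {S : VSet n} f {c} → S ≐ ｛ c ｝ → ∑pairs∈ S f ≡ 0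
    ∑pairs∈-｛｝ {S} f {c} S≐c = begin
      ∑pairs∈ S f                       ≡⟨ ∑pairs∈-as-∑∈ S f ⟩
      ∑∈ S (λ u → ∑∈ S (ordered f u))   ≡⟨ ∑∈-｛｝ _ S≐c ⟩
      ∑∈ S (ordered f c)                ≡⟨ ∑∈-｛｝ _ S≐c ⟩
      ordered f c c                     ≡⟨ ordered-diag f c ⟩
      0                                 ∎
      where open ≡-Reasoning

  ∑∈-two : ∀ f → ∑∈ X f ≡ f c₁ + f c₂
  ∑∈-two f = begin
    ∑∈ X f                               ≡⟨ ∑∈-congˡ f X≐c₁c₂ ⟩
    ∑∈ (｛ c₁ ｝ ∪ ｛ c₂ ｝) f             ≡⟨ ∑∈-∪ f c₁∩c₂≡∅ ⟩
    ∑∈ ｛ c₁ ｝ f + ∑∈ ｛ c₂ ｝ f         ≡⟨ cong₂ _+_ (∑∈-｛｝ f (λ _ → refl)) (∑∈-｛｝ f (λ _ → refl)) ⟩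
    f c₁ + f c₂                          ∎
    where open ≡-Reasoning

  wt-both : ∀ w → wt X w X ≡ wv w c₁ + wv w c₂
  wt-both w = trans (wt-self X w) (∑∈-two (wv w))

  wt-first : ∀ w {S} → S ≐ ｛ c₁ ｝ → wt X w S ≡ wv w c₁ + wo w c₁ c₂
  wt-first w {S} S≐c₁ = begin
    wt X w S
      ≡⟨ cong₂ (λ a b → a + b + ∑pairs∈ (X ∖ S) (wu w)) (∑∈-｛｝ (wv w) S≐c₁) (∑∈-｛｝ _ S≐c₁) ⟩
    wv w c₁ + ∑∈ (X ∖ S) (wo w c₁) + ∑pairs∈ (X ∖ S) (wu w)
      ≡⟨ cong₂ (λ a b → wv w c₁ + a + b) (∑∈-｛｝ (wo w c₁) X∖S≐c₂) (∑pairs∈-｛｝ (wu w) X∖S≐c₂) ⟩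
    wv w c₁ + wo w c₁ c₂ + 0
      ≡⟨ +-identityʳ _ ⟩
    wv w c₁ + wo w c₁ c₂ ∎
    where
    open ≡-Reasoning
    X∖S≐c₂ : X ∖ S ≐ ｛ c₂ ｝
    X∖S≐c₂ u rewrite X≐c₁c₂ u | S≐c₁ u with u ≟ c₁
    ... | yes refl = sym (==-≢ c₁≢c₂)
    ... | no  _    = ∧-identityʳ (u == c₂)

  wt-none : ∀ {w} → WeightLaws w → ∀ {S} → (∀ u → S u ≡ false) → wt X w S ≡ wu w c₁ c₂
  wt-none {w} laws {S} S≡∅ = begin
    wt X w S
      ≡⟨ wt-∅ X w S≡∅ ⟩
    ∑pairs∈ X (wu w)
      ≡⟨ ∑pairs∈-cong (wu w) X≐c₁c₂ ⟩
    ∑pairs∈ (｛ c₁ ｝ ∪ ｛ c₂ ｝) (wu w)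
      ≡⟨ ∑pairs∈-∪ (wu w) c₁∩c₂≡∅ (λ u v u==c₁ v==c₂ → sym (wu-sym laws u v
           (λ u≡v → c₁≢c₂ (trans (sym (==⇒≡ u==c₁)) (trans u≡v (==⇒≡ v==c₂)))))) ⟩
    (∑pairs∈ ｛ c₁ ｝ (wu w) + ∑pairs∈ ｛ c₂ ｝ (wu w)) + ∑∈ ｛ c₁ ｝ (λ u → ∑∈ ｛ c₂ ｝ (wu w u))
      ≡⟨ cong₂ _+_ (cong₂ _+_ (∑pairs∈-｛｝ (wu w) (λ _ → refl)) (∑pairs∈-｛｝ (wu w) (λ _ → refl)))
                   (trans (∑∈-｛｝ (λ u → ∑∈ ｛ c₂ ｝ (wu w u)) {c₁} (λ _ → refl)) (∑∈-｛｝ (wu w c₁) (λ _ → refl))) ⟩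
    wu w c₁ c₂ ∎
    where open ≡-Reasoning

-- The cut-partition (A, B, {c₁, c₂})

==S⇒≡ : ∀ {s t} → (s ==S t) ≡ true → s ≡ t
==S⇒≡ {inA} {inA} _ = refl
==S⇒≡ {inB} {inB} _ = refl
==S⇒≡ {inC} {inC} _ = refl
==S⇒≡ {inA} {inB} ()
==S⇒≡ {inA} {inC} ()
==S⇒≡ {inB} {inA} ()
==S⇒≡ {inB} {inC} ()
==S⇒≡ {inC} {inA} ()
==S⇒≡ {inC} {inB} ()

∸-telescope : ∀ {a y z} → z ≤ a → a ≤ y + z → (a ∸ z) + (y + z ∸ a) ≡ y
∸-telescope {a} {y} {z} z≤a a≤y+z = begin
  (a ∸ z) + (y + z ∸ a)    ≡⟨ +-comm (a ∸ z) (y + z ∸ a) ⟩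
  (y + z ∸ a) + (a ∸ z)    ≡⟨ +-∸-assoc (y + z ∸ a) z≤a ⟨
  (y + z ∸ a) + a ∸ z      ≡⟨ cong (_∸ z) (m∸n+n≡m a≤y+z) ⟩
  y + z ∸ z                ≡⟨ m+n∸n≡m y z ⟩
  y                        ∎
  where open ≡-Reasoning

module Cut {n : ℕ} (θ : Adjacency n) (w : Weight n) (side : Fin n → Side) (c₁ c₂ : Fin n)
           (θ-sym : Symmetric θ) (w-weight : IsWeightFunction (λ _ → true) θ w)
           (cut : IsCutPartition θ side c₁ c₂) where

  open CutSetup θ w side c₁ c₂
  open IsCutPartition cut

  V : VSet n
  V _ = true

  A∩C≡∅ : Disjoint A C
  A∩C≡∅ u Au rewrite ==S⇒≡ Au = refl

  B∩A≡∅ : Disjoint B A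
  B∩A≡∅ u Bu rewrite ==S⇒≡ Bu = refl

  B∩C≡∅ : Disjoint B C
  B∩C≡∅ u Bu rewrite ==S⇒≡ Bu = refl

  B∩AC≡∅ : Disjoint B AC
  B∩AC≡∅ u Bu = cong₂ _∨_ (B∩A≡∅ u Bu) (B∩C≡∅ u Bu)

  V≐B∪AC : V ≐ B ∪ AC
  V≐B∪AC u with side u
  ... | inA = refl
  ... | inB = refl
  ... | inC = refl

  C≐c₁c₂ : C ≐ ｛ c₁ ｝ ∪ ｛ c₂ ｝
  C≐c₁c₂ u with u ≟ c₁ | u ≟ c₂
  ... | yes refl | _        = cong (_==S inC) c₁∈C
  ... | no _     | yes refl = cong (_==S inC) c₂∈C
  ... | no u≢c₁  | no u≢c₂ with side u in side-u
  ...   | inA = refl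
  ...   | inB = refl
  ...   | inC with C-def u side-u
  ...     | inj₁ u≡c₁ = contradiction u≡c₁ u≢c₁
  ...     | inj₂ u≡c₂ = contradiction u≡c₂ u≢c₂

  laws : WeightLaws w
  laws = record
    { wo≤wu  = λ u v u≢v → proj₁ (proj₂ (w-weight u v refl refl u≢v))
    ; wu-sym = λ u v u≢v → proj₂ (proj₂ (w-weight u v refl refl u≢v))
    }

  no-weight-B-A : NoWeightBetween B A w
  no-weight-B-A u v Bu Av = proj₁ (w-weight u v refl refl u≢v) λ θuv≡semi →
    contradiction (trans (sym θuv≡semi) (trans (θ-sym u v) (A-B-anti v u (==S⇒≡ Av) (==S⇒≡ Bu)))) λ ()
    where u≢v = disjoint⇒≢ B∩A≡∅ Bu Av

  data PairView (u v : Fin n) : Set where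
    c₁-c₂ : u ≡ c₁ → v ≡ c₂ → PairView u v
    c₂-c₁ : u ≡ c₂ → v ≡ c₁ → PairView u v
    other : isC₁C₂ u v ≡ false → PairView u v

  private
    listing : ∀ {u v a b c d} → (u == c₁) ≡ a → (v == c₂) ≡ b → (u == c₂) ≡ c → (v == c₁) ≡ d →
              isC₁C₂ u v ≡ (a ∧ b) ∨ (c ∧ d)
    listing p q r s = cong₂ _∨_ (cong₂ _∧_ p q) (cong₂ _∧_ r s)

  pairView : ∀ u v → PairView u v
  pairView u v with u == c₁ in p | v == c₂ in q | u == c₂ in r | v == c₁ in s
  ... | true  | true  | _     | _     = c₁-c₂ (==⇒≡ p) (==⇒≡ q)
  ... | _     | _     | true  | true  = c₂-c₁ (==⇒≡ r) (==⇒≡ s)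
  ... | false | _     | false | _     = other (listing p q r s)
  ... | false | _     | true  | false = other (listing p q r s)
  ... | true  | false | false | _     = other (listing p q r s)
  ... | true  | false | true  | false = other (listing p q r s)

  c₁c₂-listed : isC₁C₂ c₁ c₂ ≡ true
  c₁c₂-listed rewrite ==-≡ {u = c₁} refl | ==-≡ {u = c₂} refl = refl

  c₂c₁-listed : isC₁C₂ c₂ c₁ ≡ true
  c₂c₁-listed rewrite ==-≡ {u = c₁} refl | ==-≡ {u = c₂} refl = ∨-zeroʳ _

  θ'-unlisted : ∀ {u v} → isC₁C₂ u v ≡ false → θ' u v ≡ θ u v
  θ'-unlisted {u} {v} unlisted = cong (λ b → if b then semi else θ u v) unlisted

  θ'-strong : ∀ u v → isStrong (θ' u v) ≡ isStrong (θ u v)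
  θ'-strong u v with pairView u v
  ... | c₁-c₂ refl refl rewrite c₁c₂-listed = sym (not-strong C-stable)
  ... | c₂-c₁ refl refl rewrite c₂c₁-listed = sym (not-strong (C-stable ∘ trans (θ-sym c₁ c₂)))
  ... | other unlisted = cong isStrong (θ'-unlisted unlisted)

  independent-θ' : ∀ {S} → Independent θ S → Independent θ' S
  independent-θ' indep u v Su Sv u≢v = trans (θ'-strong u v) (indep u v Su Sv u≢v)

  independent-θ : ∀ {S} → Independent θ' S → Independent θ S
  independent-θ indep u v Su Sv u≢v = trans (sym (θ'-strong u v)) (indep u v Su Sv u≢v)

  C-independent : Independent θ' C
  C-independent u v Cu Cv u≢v = trans (θ'-strong u v) (on-C (C-def u (==S⇒≡ Cu)) (C-def v (==S⇒≡ Cv)))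
    where
    on-C : u ≡ c₁ ⊎ u ≡ c₂ → v ≡ c₁ ⊎ v ≡ c₂ → isStrong (θ u v) ≡ false
    on-C (inj₁ refl) (inj₂ refl) = not-strong C-stable
    on-C (inj₂ refl) (inj₁ refl) = not-strong (C-stable ∘ trans (θ-sym c₁ c₂))
    on-C (inj₁ refl) (inj₁ refl) = contradiction refl u≢v
    on-C (inj₂ refl) (inj₂ refl) = contradiction refl u≢v

  C-c₁ : C c₁ ≡ true
  C-c₁ = cong (_==S inC) c₁∈C

  C-c₂ : C c₂ ≡ true
  C-c₂ = cong (_==S inC) c₂∈C

  ｛c₁｝⊆C : ｛ c₁ ｝ ⊆ C
  ｛c₁｝⊆C u u==c₁ rewrite ==⇒≡ u==c₁ = C-c₁

  ｛c₂｝⊆C : ｛ c₂ ｝ ⊆ C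
  ｛c₂｝⊆C u u==c₂ rewrite ==⇒≡ u==c₂ = C-c₂

  A∪-mono : ∀ {C' C''} → C' ⊆ C'' → A ∪ C' ⊆ A ∪ C''
  A∪-mono C'⊆C'' u A∪C'u with A u
  ... | true  = refl
  ... | false = C'⊆C'' u A∪C'u

  α[]-upper : ∀ {C' S} → C' ⊆ C → Stable AC θ' S → S ⊆ A ∪ C' → wt AC w S ≤ α[ C' ]
  α[]-upper C'⊆C = αRedExt-upper laws (A∪-mono C'⊆C)

  α[]-attained : ∀ {C'} → C' ⊆ C → Σ[ S ∈ VSet n ] Stable AC θ' S × S ⊆ A ∪ C' × α[ C' ] ≤ wt AC w S
  α[]-attained C'⊆C = αRedExt-attained θ' laws (A∪-mono C'⊆C)

  α[]-cong : ∀ {C' C''} → C' ≐ C'' → α[ C' ] ≡ α[ C'' ]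
  α[]-cong C'≐C'' = αRedExt-cong AC θ' w (λ u → cong (A u ∨_) (C'≐C'' u))

  α[]-drop : ∀ {C' C''} c → C' ⊆ C → C'' ⊆ C → C' ∖ ｛ c ｝ ⊆ C'' → α[ C' ] ≤ α[ C'' ] + wv w c
  α[]-drop {C'} {C''} c C'⊆C C''⊆C C'∖c⊆C'' = from-best (α[]-attained C'⊆C)
    where
    from-best : Σ[ S ∈ VSet n ] Stable AC θ' S × S ⊆ A ∪ C' × α[ C' ] ≤ wt AC w S → α[ C' ] ≤ α[ C'' ] + wv w c
    from-best (S , stable , S⊆A∪C' , α≤) =
      ≤-trans α≤ (≤-trans (wt-remove-one {X = AC} {S = S} laws (proj₁ stable) c)
        (+-monoˡ-≤ (wv w c) (α[]-upper C''⊆C (stable-⊆ (∖-⊆ S ｛ c ｝) stable) S∖c⊆A∪C'')))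
      where
      S∖c⊆A∪C'' : S ∖ ｛ c ｝ ⊆ A ∪ C''
      S∖c⊆A∪C'' u S∖cu with S u in Su | A u in Au
      ... | true | true  = refl
      ... | true | false = C'∖c⊆C'' u (cong₂ _∧_ (trans (sym (cong (_∨ C' u) Au)) (S⊆A∪C' u Su)) S∖cu)

  ⊆A∪ : ∀ {C'} → C' ⊆ A ∪ C'
  ⊆A∪ {C'} u C'u = trans (cong (A u ∨_) C'u) (∨-zeroʳ (A u))

  c₂≤αAC : wv w c₂ ≤ αAC
  c₂≤αAC = ≤-trans (wv≤wt-｛｝ AC w c₂) (α[]-upper (λ _ → id) (｛｝-stable (⊆A∪ {C} c₂ C-c₂)) (⊆-trans ｛c₂｝⊆C ⊆A∪))

  c₂≤αAc₂ : wv w c₂ ≤ αAc₂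
  c₂≤αAc₂ = ≤-trans (wv≤wt-｛｝ AC w c₂) (α[]-upper ｛c₂｝⊆C (｛｝-stable (⊆A∪ {C} c₂ C-c₂)) ⊆A∪)

  c₁+c₂≤αAC : wv w c₁ + wv w c₂ ≤ αAC
  c₁+c₂≤αAC = begin
    wv w c₁ + wv w c₂  ≡⟨ TwoPoints.∑∈-two c₁≢c₂ C≐c₁c₂ (wv w) ⟨
    ∑∈ C (wv w)        ≤⟨ vertices≤wt AC w C ⟩
    wt AC w C          ≤⟨ α[]-upper (λ _ → id) (⊆A∪ , C-independent) ⊆A∪ ⟩
    αAC                ∎
    where open ≤-Reasoning

  αAC≤αAc₁+c₂ : αAC ≤ αAc₁ + wv w c₂
  αAC≤αAc₁+c₂ = α[]-drop c₂ (λ _ → id) ｛c₁｝⊆C C∖c₂⊆c₁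
    where
    C∖c₂⊆c₁ : C ∖ ｛ c₂ ｝ ⊆ ｛ c₁ ｝
    C∖c₂⊆c₁ u C∖c₂u with u == c₁ in p | u == c₂ in q
    ... | true  | _     = refl
    ... | false | true  = contradiction (trans (sym C∖c₂u) (∧-zeroʳ (C u))) λ ()
    ... | false | false =
      contradiction (trans (sym C∖c₂u) (cong (_∧ true) (trans (C≐c₁c₂ u) (cong₂ _∨_ p q)))) λ ()

  αAc₂≤αA+c₂ : αAc₂ ≤ αA + wv w c₂
  αAc₂≤αA+c₂ = α[]-drop c₂ ｛c₂｝⊆C (λ _ ()) (∖-self ｛ c₂ ｝)

  αAc₁+c₂≤αA+αAC : αAc₁ + wv w c₂ ≤ αA + αAC
  αAc₁+c₂≤αA+αAC = begin
    αAc₁ + wv w c₂              ≤⟨ +-monoˡ-≤ (wv w c₂) (α[]-drop c₁ ｛c₁｝⊆C (λ _ ()) (∖-self ｛ c₁ ｝)) ⟩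
    αA + wv w c₁ + wv w c₂      ≡⟨ +-assoc αA (wv w c₁) (wv w c₂) ⟩
    αA + (wv w c₁ + wv w c₂)    ≤⟨ +-monoʳ-≤ αA c₁+c₂≤αAC ⟩
    αA + αAC                    ∎
    where open ≤-Reasoning

  private
    listed-sym : ∀ u v → isC₁C₂ u v ≡ isC₁C₂ v u
    listed-sym u v = trans (∨-comm ((u == c₁) ∧ (v == c₂)) ((u == c₂) ∧ (v == c₁)))
                           (cong₂ _∨_ (∧-comm (u == c₂) (v == c₁)) (∧-comm (u == c₁) (v == c₂)))

    ∨-false : ∀ {a b} → a ∨ b ≡ false → a ≡ false × b ≡ false
    ∨-false {false} b≡false = refl , b≡false

  wB-unlisted : ∀ {u v} → isC₁C₂ u v ≡ false → wo wB u v ≡ wo w u v × wu wB u v ≡ wu w u v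
  wB-unlisted {u} {v} unlisted with ∨-false {(u == c₁) ∧ (v == c₂)} unlisted
  ... | first , second rewrite first | second | unlisted = refl , refl

  wB-c₁ : wv wB c₁ ≡ αAC ∸ wv w c₂
  wB-c₁ rewrite ==-≡ {u = c₁} refl = refl

  wB-c₂ : wv wB c₂ ≡ wv w c₂
  wB-c₂ rewrite ==-≢ (c₁≢c₂ ∘ sym) | ==-≡ {u = c₂} refl = refl

  wB-c₁c₂ : wo wB c₁ c₂ ≡ (αAc₁ + wv w c₂) ∸ αAC
  wB-c₁c₂ rewrite ==-≡ {u = c₁} refl | ==-≡ {u = c₂} refl = refl

  wB-c₂c₁ : wo wB c₂ c₁ ≡ αAc₂ ∸ wv w c₂
  wB-c₂c₁ rewrite ==-≢ (c₁≢c₂ ∘ sym) | ==-≡ {u = c₁} refl | ==-≡ {u = c₂} refl = refl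

  wB-listed : ∀ {u v} → isC₁C₂ u v ≡ true → wu wB u v ≡ αA
  wB-listed listed rewrite listed = refl

  wB-laws : WeightLaws wB
  wB-laws = record { wo≤wu = wo≤wu-B ; wu-sym = wu-sym-B }
    where
    wo≤wu-B : ∀ u v → u ≢ v → wo wB u v ≤ wu wB u v
    wo≤wu-B u v u≢v with pairView u v
    ... | c₁-c₂ refl refl = subst₂ _≤_ (sym wB-c₁c₂) (sym (wB-listed c₁c₂-listed))
      (m≤n+o⇒m∸n≤o (αAc₁ + wv w c₂) αAC (≤-trans αAc₁+c₂≤αA+αAC (≤-reflexive (+-comm αA αAC))))
    ... | c₂-c₁ refl refl = subst₂ _≤_ (sym wB-c₂c₁) (sym (wB-listed c₂c₁-listed))
      (m≤n+o⇒m∸n≤o αAc₂ (wv w c₂) (≤-trans αAc₂≤αA+c₂ (≤-reflexive (+-comm αA (wv w c₂)))))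
    ... | other unlisted = subst₂ _≤_ (sym (proj₁ (wB-unlisted unlisted))) (sym (proj₂ (wB-unlisted unlisted)))
                                  (wo≤wu laws u v u≢v)
    wu-sym-B : ∀ u v → u ≢ v → wu wB u v ≡ wu wB v u
    wu-sym-B u v u≢v with pairView u v
    ... | c₁-c₂ refl refl = trans (wB-listed c₁c₂-listed) (sym (wB-listed c₂c₁-listed))
    ... | c₂-c₁ refl refl = trans (wB-listed c₂c₁-listed) (sym (wB-listed c₁c₂-listed))
    ... | other unlisted  = trans (proj₂ (wB-unlisted unlisted))
      (trans (wu-sym laws u v u≢v) (sym (proj₂ (wB-unlisted (trans (listed-sym v u) unlisted)))))

  wB-weight : IsWeightFunction BC θ' wB
  wB-weight u v _ _ u≢v = zero-unless-semi , wo≤wu wB-laws u v u≢v , wu-sym wB-laws u v u≢v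
    where
    zero-unless-semi : θ' u v ≢ semi → wo wB u v ≡ 0 × wo wB v u ≡ 0 × wu wB u v ≡ 0
    zero-unless-semi not-semi with pairView u v
    ... | c₁-c₂ refl refl = contradiction (cong (λ b → if b then semi else θ c₁ c₂) c₁c₂-listed) not-semi
    ... | c₂-c₁ refl refl = contradiction (cong (λ b → if b then semi else θ c₂ c₁) c₂c₁-listed) not-semi
    ... | other unlisted with proj₁ (w-weight u v refl refl u≢v) (not-semi ∘ trans (θ'-unlisted unlisted))
    ...   | wo₀ , wo₀' , wu₀ = trans (proj₁ (wB-unlisted unlisted)) wo₀
                             , trans (proj₁ (wB-unlisted (trans (listed-sym v u) unlisted))) wo₀'
                             , trans (proj₂ (wB-unlisted unlisted)) wu₀

  wB-agrees : AgreeOutside C w wB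
  wB-agrees u Cu≡false = vertex , λ v → sym (proj₁ (wB-unlisted (unlisted-from v)))
                                      , sym (proj₁ (wB-unlisted (trans (listed-sym v u) (unlisted-from v))))
                                      , sym (proj₂ (wB-unlisted (unlisted-from v)))
    where
    u≢c₁ : u ≢ c₁
    u≢c₁ refl = contradiction (trans (sym Cu≡false) C-c₁) λ ()
    u≢c₂ : u ≢ c₂
    u≢c₂ refl = contradiction (trans (sym Cu≡false) C-c₂) λ ()
    vertex : wv w u ≡ wv wB u
    vertex rewrite ==-≢ u≢c₁ | ==-≢ u≢c₂ = refl
    unlisted-from : ∀ v → isC₁C₂ u v ≡ false
    unlisted-from v rewrite ==-≢ u≢c₁ | ==-≢ u≢c₂ = refl

  private
    in-C : ∀ {u} → C u ≡ true → u ≡ c₁ ⊎ u ≡ c₂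
    in-C {u} Cu = C-def u (==S⇒≡ Cu)

    c₂≢c₁ : c₂ ≢ c₁
    c₂≢c₁ = c₁≢c₂ ∘ sym

  ⊆C-ext : ∀ {T S} → T ⊆ C → S ⊆ C → T c₁ ≡ S c₁ → T c₂ ≡ S c₂ → T ≐ S
  ⊆C-ext {T} {S} T⊆C S⊆C same₁ same₂ u = ⇔→≡ {z = true} (mk⇔
    (λ Tu → trans (sym (agree-at (in-C (T⊆C u Tu)))) Tu)
    (λ Su → trans (agree-at (in-C (S⊆C u Su))) Su))
    where
    agree-at : ∀ {v} → v ≡ c₁ ⊎ v ≡ c₂ → T v ≡ S v
    agree-at (inj₁ refl) = same₁
    agree-at (inj₂ refl) = same₂

  module C₁C₂ = TwoPoints c₁≢c₂ C≐c₁c₂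
  module C₂C₁ = TwoPoints c₂≢c₁ (λ u → trans (C≐c₁c₂ u) (∨-comm (u == c₁) (u == c₂)))

  wt-C-wB : ∀ {T} → T ⊆ C → wt C wB T ≡ α[ T ]
  wt-C-wB {T} T⊆C = by-trace (T c₁) (T c₂) refl refl
    where
    open ≡-Reasoning
    by-trace : ∀ t₁ t₂ → T c₁ ≡ t₁ → T c₂ ≡ t₂ → wt C wB T ≡ α[ T ]
    by-trace true true Tc₁ Tc₂ = begin
      wt C wB T                         ≡⟨ wt-congˢ C wB T≐C ⟩
      wt C wB C                         ≡⟨ C₁C₂.wt-both wB ⟩
      wv wB c₁ + wv wB c₂               ≡⟨ cong₂ _+_ wB-c₁ wB-c₂ ⟩
      αAC ∸ wv w c₂ + wv w c₂           ≡⟨ m∸n+n≡m c₂≤αAC ⟩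
      α[ C ]                            ≡⟨ α[]-cong T≐C ⟨
      α[ T ]                            ∎
      where T≐C = ⊆C-ext T⊆C (λ _ → id) (trans Tc₁ (sym C-c₁)) (trans Tc₂ (sym C-c₂))
    by-trace true false Tc₁ Tc₂ = begin
      wt C wB T                                           ≡⟨ C₁C₂.wt-first wB T≐c₁ ⟩
      wv wB c₁ + wo wB c₁ c₂                              ≡⟨ cong₂ _+_ wB-c₁ wB-c₁c₂ ⟩
      αAC ∸ wv w c₂ + (αAc₁ + wv w c₂ ∸ αAC)              ≡⟨ ∸-telescope c₂≤αAC αAC≤αAc₁+c₂ ⟩
      α[ ｛ c₁ ｝ ]                                        ≡⟨ α[]-cong T≐c₁ ⟨
      α[ T ]                                              ∎
      where T≐c₁ = ⊆C-ext T⊆C ｛c₁｝⊆C (trans Tc₁ (sym (==-≡ refl))) (trans Tc₂ (sym (==-≢ c₂≢c₁)))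
    by-trace false true Tc₁ Tc₂ = begin
      wt C wB T                                           ≡⟨ C₂C₁.wt-first wB T≐c₂ ⟩
      wv wB c₂ + wo wB c₂ c₁                              ≡⟨ cong₂ _+_ wB-c₂ wB-c₂c₁ ⟩
      wv w c₂ + (αAc₂ ∸ wv w c₂)                          ≡⟨ m+[n∸m]≡n c₂≤αAc₂ ⟩
      α[ ｛ c₂ ｝ ]                                        ≡⟨ α[]-cong T≐c₂ ⟨
      α[ T ]                                              ∎
      where T≐c₂ = ⊆C-ext T⊆C ｛c₂｝⊆C (trans Tc₁ (sym (==-≢ c₁≢c₂))) (trans Tc₂ (sym (==-≡ refl)))
    by-trace false false Tc₁ Tc₂ = begin
      wt C wB T                                           ≡⟨ C₁C₂.wt-none wB-laws (λ u → T≐∅ u) ⟩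
      wu wB c₁ c₂                                         ≡⟨ wB-listed c₁c₂-listed ⟩
      α[ ∅ ]                                              ≡⟨ α[]-cong T≐∅ ⟨
      α[ T ]                                              ∎
      where T≐∅ = ⊆C-ext T⊆C (λ _ ()) Tc₁ Tc₂

  glue : ∀ S → wt V w S + wt C wB (S ∩ C) ≡ wt AC w (S ∩ AC) + wt BC wB (S ∩ BC)
  glue S = +-cancelʳ-≡ (wt C w (S ∩ C)) _ _ (begin
    (wt V w S + wt C wB (S ∩ C)) + wt C w (S ∩ C)
      ≡⟨ swap-last (wt V w S) (wt C wB (S ∩ C)) (wt C w (S ∩ C)) ⟩
    (wt V w S + wt C w (S ∩ C)) + wt C wB (S ∩ C)
      ≡⟨ cong (_+ wt C wB (S ∩ C)) (trans (cong (_+ wt C w (S ∩ C)) (wt-congˣ w S V≐B∪AC))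
              (wt-glue laws A∩C≡∅ B∩A≡∅ B∩C≡∅ no-weight-B-A (λ u _ → sym (V≐B∪AC u)))) ⟩
    (wt AC w (S ∩ AC) + wt BC w (S ∩ BC)) + wt C wB (S ∩ C)
      ≡⟨ +-assoc (wt AC w (S ∩ AC)) (wt BC w (S ∩ BC)) (wt C wB (S ∩ C)) ⟩
    wt AC w (S ∩ AC) + (wt BC w (S ∩ BC) + wt C wB (S ∩ C))
      ≡⟨ cong (wt AC w (S ∩ AC) +_) reweight ⟨
    wt AC w (S ∩ AC) + (wt BC wB (S ∩ BC) + wt C w (S ∩ C))
      ≡⟨ +-assoc (wt AC w (S ∩ AC)) (wt BC wB (S ∩ BC)) (wt C w (S ∩ C)) ⟨
    (wt AC w (S ∩ AC) + wt BC wB (S ∩ BC)) + wt C w (S ∩ C) ∎)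
    where
    open ≡-Reasoning
    swap-last : ∀ a b c → (a + b) + c ≡ (a + c) + b
    swap-last = solve-∀
    S∩BC∩C≐S∩C : (S ∩ BC) ∩ C ≐ S ∩ C
    S∩BC∩C≐S∩C = ∩-absorb {Y = BC} {S} (λ u Cu → trans (cong (B u ∨_) Cu) (∨-zeroʳ (B u)))
    reweight : wt BC wB (S ∩ BC) + wt C w (S ∩ C) ≡ wt BC w (S ∩ BC) + wt C wB (S ∩ C)
    reweight = begin
      wt BC wB (S ∩ BC) + wt C w (S ∩ C)
        ≡⟨ cong (wt BC wB (S ∩ BC) +_) (wt-congˢ C w S∩BC∩C≐S∩C) ⟨
      wt BC wB (S ∩ BC) + wt C w ((S ∩ BC) ∩ C)
        ≡⟨ wt-∪-reweight laws wB-laws wB-agrees B∩C≡∅ (∩-⊆ʳ S BC) ⟩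
      wt BC w (S ∩ BC) + wt C wB ((S ∩ BC) ∩ C)
        ≡⟨ cong (wt BC w (S ∩ BC) +_) (wt-congˢ C wB S∩BC∩C≐S∩C) ⟩
      wt BC w (S ∩ BC) + wt C wB (S ∩ C) ∎

  wt≤wt-B : ∀ {S} → Independent θ S → wt V w S ≤ wt BC wB (S ∩ BC)
  wt≤wt-B {S} indep = +-cancelʳ-≤ (wt C wB (S ∩ C)) _ _ (begin
    wt V w S + wt C wB (S ∩ C)              ≡⟨ glue S ⟩
    wt AC w (S ∩ AC) + wt BC wB (S ∩ BC)    ≤⟨ +-monoˡ-≤ _ (α[]-upper (∩-⊆ʳ S C) stable-A S∩AC⊆A∪S∩C) ⟩
    α[ S ∩ C ] + wt BC wB (S ∩ BC)          ≡⟨ cong (_+ wt BC wB (S ∩ BC)) (wt-C-wB (∩-⊆ʳ S C)) ⟨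
    wt C wB (S ∩ C) + wt BC wB (S ∩ BC)     ≡⟨ +-comm (wt C wB (S ∩ C)) (wt BC wB (S ∩ BC)) ⟩
    wt BC wB (S ∩ BC) + wt C wB (S ∩ C)     ∎)
    where
    open ≤-Reasoning
    stable-A : Stable AC θ' (S ∩ AC)
    stable-A = ∩-⊆ʳ S AC , independent-θ' (independent-⊆ (∩-⊆ˡ S AC) indep)
    S∩AC⊆A∪S∩C : S ∩ AC ⊆ A ∪ (S ∩ C)
    S∩AC⊆A∪S∩C u S∩ACu with S u | A u
    ... | true | true  = refl
    ... | true | false = S∩ACu

  module _ {T S'} (T-stable : Stable BC θ' T) (S'-stable : Stable AC θ' S') (S'⊆A∪TC : S' ⊆ A ∪ (T ∩ C)) where

    private
      S'-in-T : ∀ u → S' u ≡ true → A u ≡ false → T u ≡ true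
      S'-in-T u S'u Au = ∩-⊆ˡ T C u (trans (sym (cong (_∨ (T ∩ C) u) Au)) (S'⊆A∪TC u S'u))

    glued-stable : Stable V θ ((B ∩ T) ∪ S')
    glued-stable = (λ _ _ → refl)
                 , independent-∪ θ-sym (independent-θ (independent-⊆ (∩-⊆ʳ B T) (proj₂ T-stable)))
                                       (independent-θ (proj₂ S'-stable)) across
      where
      across : ∀ u v → (B ∩ T) u ≡ true → S' v ≡ true → u ≢ v → isStrong (θ u v) ≡ false
      across u v BTu S'v u≢v with A v in Av
      ... | true  = cong isStrong (trans (θ-sym u v) (A-B-anti v u (==S⇒≡ Av) (==S⇒≡ (∩-⊆ˡ B T u BTu))))
      ... | false = trans (sym (θ'-strong u v)) (proj₂ T-stable u v (∩-⊆ʳ B T u BTu) (S'-in-T v S'v Av) u≢v)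

    wt-B≤wt-glued : α[ T ∩ C ] ≤ wt AC w S' → wt BC wB T ≤ wt V w ((B ∩ T) ∪ S')
    wt-B≤wt-glued α≤ = +-cancelʳ-≤ (wt C wB (S ∩ C)) _ _ (begin
      wt BC wB T + wt C wB (S ∩ C)
        ≡⟨ cong (wt BC wB T +_) (wt-congˢ C wB (∩-absorb {Y = BC} {S} C⊆BC)) ⟨
      wt BC wB T + wt C wB ((S ∩ BC) ∩ C)
        ≤⟨ wt-∪-antitone wB-laws B∩C≡∅ S∩BC⊆T T∖S∩BC⊆C (proj₁ T-stable) ⟩
      wt BC wB (S ∩ BC) + wt C wB (T ∩ C)
        ≡⟨ cong (wt BC wB (S ∩ BC) +_) (wt-C-wB (∩-⊆ʳ T C)) ⟩
      wt BC wB (S ∩ BC) + α[ T ∩ C ]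
        ≤⟨ +-monoʳ-≤ (wt BC wB (S ∩ BC)) α≤ ⟩
      wt BC wB (S ∩ BC) + wt AC w S'
        ≡⟨ cong (wt BC wB (S ∩ BC) +_) (wt-congˢ AC w S∩AC≐S') ⟨
      wt BC wB (S ∩ BC) + wt AC w (S ∩ AC)
        ≡⟨ +-comm (wt BC wB (S ∩ BC)) (wt AC w (S ∩ AC)) ⟩
      wt AC w (S ∩ AC) + wt BC wB (S ∩ BC)
        ≡⟨ glue S ⟨
      wt V w S + wt C wB (S ∩ C) ∎)
      where
      open ≤-Reasoning
      S = (B ∩ T) ∪ S'
      S'⊆AC = proj₁ S'-stable
      C⊆BC : C ⊆ BC
      C⊆BC u Cu = trans (cong (B u ∨_) Cu) (∨-zeroʳ (B u))
      S∩AC≐S' : S ∩ AC ≐ S'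
      S∩AC≐S' u with B u in Bu | S' u in S'u
      ... | true  | false = trans (cong ((T u ∨ false) ∧_) (B∩AC≡∅ u Bu)) (∧-zeroʳ (T u ∨ false))
      ... | true  | true  = contradiction (trans (sym (S'⊆AC u S'u)) (B∩AC≡∅ u Bu)) λ ()
      ... | false | true  = S'⊆AC u S'u
      ... | false | false = refl
      S∩BC⊆T : S ∩ BC ⊆ T
      S∩BC⊆T u S∩BCu with B u in Bu | S' u in S'u
      ... | true  | true  = contradiction (trans (sym (S'⊆AC u S'u)) (B∩AC≡∅ u Bu)) λ ()
      ... | true  | false = trans (sym (trans (∧-identityʳ (T u ∨ false)) (∨-identityʳ (T u)))) S∩BCu
      ... | false | true  = S'-in-T u S'u (disjoint-sym A∩C≡∅ u S∩BCu)
      T∖S∩BC⊆C : T ∖ (S ∩ BC) ⊆ C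
      T∖S∩BC⊆C u T∖u with B u in Bu | T u in Tu
      ... | false | true = trans (sym (cong (_∨ C u) Bu)) (proj₁ T-stable u Tu)

  α≤α-B : α V θ w ≤ α BC θ' wB
  α≤α-B = from-best (α-attained V θ w)
    where
    from-best : Σ[ S ∈ VSet n ] Stable V θ S × α V θ w ≤ wt V w S → α V θ w ≤ α BC θ' wB
    from-best (S , (_ , indep) , α≤) =
      ≤-trans α≤ (≤-trans (wt≤wt-B indep) (α-upper wB S∩BC-stable))
      where
      S∩BC-stable : Stable BC θ' (S ∩ BC)
      S∩BC-stable = ∩-⊆ʳ S BC , independent-θ' (independent-⊆ (∩-⊆ˡ S BC) indep)

  α-B≤α : α BC θ' wB ≤ α V θ w
  α-B≤α = from-best-B (α-attained BC θ' wB)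
    where
    from-best-B : Σ[ T ∈ VSet n ] Stable BC θ' T × α BC θ' wB ≤ wt BC wB T → α BC θ' wB ≤ α V θ w
    from-best-B (T , T-stable , α≤) = ≤-trans α≤ (from-best-A (α[]-attained (∩-⊆ʳ T C)))
      where
      from-best-A : Σ[ S' ∈ VSet n ] Stable AC θ' S' × S' ⊆ A ∪ (T ∩ C) × α[ T ∩ C ] ≤ wt AC w S' →
                    wt BC wB T ≤ α V θ w
      from-best-A (S' , S'-stable , S'⊆A∪TC , α≤') =
        ≤-trans (wt-B≤wt-glued T-stable S'-stable S'⊆A∪TC α≤')
                (α-upper w (glued-stable T-stable S'-stable S'⊆A∪TC))

lemma3p11 : {n : ℕ} (θ : Adjacency n) (w : Weight n) (side : Fin n → Side) (c₁ c₂ : Fin n) →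
    Symmetric θ →
    IsWeightFunction (λ _ → true) θ w →
    IsCutPartition θ side c₁ c₂ →
    let open CutSetup θ w side c₁ c₂ in
      (wv w c₂ ≤ αAC) × (αAC ≤ αAc₁ + wv w c₂) × (wv w c₂ ≤ αAc₂)
      × IsWeightFunction BC θ' wB
      × (α BC θ' wB ≡ α (λ _ → true) θ w)
lemma3p11 θ w side c₁ c₂ θ-sym w-weight cut =
  c₂≤αAC , αAC≤αAc₁+c₂ , c₂≤αAc₂ , wB-weight , ≤-antisym α-B≤α α≤α-B
  where open Cut θ w side c₁ c₂ θ-sym w-weight cut
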